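{- Let $\Sigma,\Sigma'$ be spatial conjunctions and $s$ a stack with $s\models\mathrm{WellFormed}(\Sigma)$. Then: (i) the procedure $\mathrm{Match}(s,\Sigma,\Sigma,\Sigma')$ always terminates (for any choices made in its nondeterministic steps) with a result $U$ (a pure formula); (ii) the execution requires $O(n)$ recursive steps, where $n=|\Sigma|+|\Sigma'|$; (iii) if $s\models U$ then the entailment $U\land\Sigma\rightarrow\Sigma'$ is valid; (iv) if $s\not\models U$ then $s\not\models\Sigma\rightarrow\Sigma'$, i.e. there exists a heap $h$ with $s,h\models\Sigma$ and $s,h\not\models\Sigma'$.
   Context: Setting: a many-sorted first-order language with sorts including $\mathsf{Int}$ and $\mathsf{Bool}$, equality $\simeq$, classical boolean connectives, and possibly further theory symbols with standard interpretations. Pure = containing no spatial symbol. A stack $s$ maps variables to values of their sorts and is extended to pure expressions. A heap is a partial function $h\colon\mathbb{Z}\rightharpoonup\mathsf{Val}$; $h=h_1\ast\dots\ast h_n$ means $h$ is the union of the $h_i$ with pairwise disjoint domains. Spatial predicates: $\mathrm{emp}$, $\mathrm{next}(x,y)$, $\mathrm{lseg}(x,y)$ with $x,y$ pure $\mathsf{Int}$ expressions. A spatial conjunction $\Sigma=S_1\ast\dots\ast S_n$ ($n\ge0$) is a finite multiset of spatial predicates; $|\Sigma|=n$; $S\in\Sigma$, $\Sigma\setminus S$ (remove one occurrence) and $\ast$ (multiset union) are multiset operations; the empty conjunction denotes $\mathrm{emp}$. Semantics: $s,h\models\Pi$ (pure) iff $s(\Pi)=\top$; $s,h\models\mathrm{emp}$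 iff $h=\emptyset$; $s,h\models\mathrm{next}(x,y)$ iff $h=\{s(x)\mapsto s(y)\}$; $s,h\models F_1\ast F_2$ iff $h=h_1\ast h_2$ with $s,h_i\models F_i$; $s,h\models\mathrm{lseg}(x,z)$ iff there are $n\ge0$ and integers $a_0,\dots,a_n$ with $a_0=s(x)$, $a_n=s(z)$, $a_i\ne s(z)$ for $i<n$ and $h=\{a_0\mapsto a_1\}\ast\dots\ast\{a_{n-1}\mapsto a_n\}$; $\land,\lor,\lnot,\rightarrow$ classical. A formula $F$ is valid if $s,h\models F$ for all stacks $s$ and heaps $h$; $s\models F$ means $s,h\models F$ for every heap $h$. Auxiliary definitions: $\mathrm{Empty}(\mathrm{emp})=\top$, $\mathrm{Empty}(\mathrm{next}(x,y))=\bot$, $\mathrm{Empty}(\mathrm{lseg}(x,y))=(x\simeq y)$; $\mathrm{Addr}(\mathrm{next}(x,y))=\mathrm{Addr}(\mathrm{lseg}(x,y))=x$. $\mathrm{Collide}(S,S')=\lnot\mathrm{Empty}(S)\land\lnot\mathrm{Empty}(S')\land\mathrm{Addr}(S)\simeq\mathrm{Addr}(S')$ ($\bot$ if either is $\mathrm{emp}$). $\mathrm{WellFormed}(S_1\ast\dots\ast S_n)=\bigwedge_{1\le i<j\le n}\lnot\mathrm{Collide}(S_i,S_j)$. $\mathrm{Alloc}(S_1\ast\dots\ast S_n,x)=\bigvee_{1\le i\le n}(\lnot\mathrm{Empty}(S_i)\land x\simeq\mathrm{Addr}(S_i))$. For $S\in\{\mathrm{next}(x,y),\mathrm{lseg}(x,y)\}$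 and $S'\in\{\mathrm{next}(x',z),\mathrm{lseg}(x',z)\}$, $\mathrm{Update}(S,S')$ and $\mathrm{Check}(\hat\Sigma,S,S')$ are: for $(S,S')=(\mathrm{next}(x,y),\mathrm{next}(x',z))$: $\mathrm{emp}$ and $y\simeq z$; for $(\mathrm{next}(x,y),\mathrm{lseg}(x',z))$: $\mathrm{lseg}(y,z)$ and $\top$; for $(\mathrm{lseg}(x,y),\mathrm{next}(x',z))$: $\mathrm{emp}$ and $\bot$; for $(\mathrm{lseg}(x,y),\mathrm{lseg}(x',z))$: $\mathrm{lseg}(y,z)$ and $y\not\simeq z\rightarrow\mathrm{Alloc}(\hat\Sigma,z)$. $\mathrm{Guard}(\hat\Sigma,S,S')=\mathrm{Collide}(S,S')\land\mathrm{Check}(\hat\Sigma,S,S')$ (taken to be $\bot$ if $S$ or $S'$ is $\mathrm{emp}$). The procedure $\mathrm{Match}(s,\hat\Sigma,\Sigma,\Sigma')$ (stack $s$, spatial conjunctions $\hat\Sigma,\Sigma,\Sigma'$) returns a pure formula as follows, where each "if there exists" picks an arbitrary witness: 1. If there is $S\in\Sigma$ with $s\models\mathrm{Empty}(S)$: return $\mathrm{Empty}(S)\land\mathrm{Match}(s,\hat\Sigma,\Sigma\setminus S,\Sigma')$. 2. Else if there is $S'\in\Sigma'$ with $s\models\mathrm{Empty}(S')$: return $\mathrm{Empty}(S')\land\mathrm{Match}(s,\hat\Sigma,\Sigma,\Sigma'\setminus S')$. 3. Else if there are $S\in\Sigma$, $S'\in\Sigma'$ with $s\models\mathrm{Guard}(\hat\Sigma,S,S')$: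 return $\mathrm{Guard}(\hat\Sigma,S,S')\land\mathrm{Match}(s,\hat\Sigma,\Sigma\setminus S,(\Sigma'\setminus S')\ast\mathrm{Update}(S,S'))$. 4. Else return $\top$ if both $\Sigma$ and $\Sigma'$ are empty, and $\bot$ otherwise. -}

module Defs where

open import Data.Nat using (ℕ; zero; suc; _+_; _*_; _≤_)
open import Data.Integer as ℤ using (ℤ)
open import Data.Bool using (Bool; true; false; _∧_; _∨_; not)
open import Data.Maybe using (Maybe; just; nothing)
open import Data.List using (List; []; _∷_; length)
open import Data.List.Relation.Unary.Any using (_─_)
open import Data.List.Membership.Propositional using (_∈_)
open import Data.Fin using (Fin; fromℕ; inject₁) renaming (zero to fzero; suc to fsuc)
open import Data.Product using (Σ; ∃; ∃-syntax; _×_; _,_)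
open import Data.Sum using (_⊎_)
open import Relation.Nullary using (¬_; ⌊_⌋)
open import Relation.Binary.PropositionalEquality using (_≡_; _≢_)

Var : Set
Var = ℕ

Stack : Set
Stack = Var → ℤ

data Expr : Set where
  var   : Var → Expr
  const : ℤ → Expr
  _⊕_   : Expr → Expr → Expr
  _⊖_   : Expr → Expr → Expr
  _⊗_   : Expr → Expr → Expr

⟦_⟧ₑ : Expr → Stack → ℤ
⟦ var x ⟧ₑ s = s x
⟦ const c ⟧ₑ s = c
⟦ e ⊕ f ⟧ₑ s = ⟦ e ⟧ₑ s ℤ.+ ⟦ f ⟧ₑ s
⟦ e ⊖ f ⟧ₑ s = ⟦ e ⟧ₑ s ℤ.- ⟦ f ⟧ₑ s
⟦ e ⊗ f ⟧ₑ s = ⟦ e ⟧ₑ s ℤ.* ⟦ f ⟧ₑ s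

data Pure : Set where
  ⊤ᵖ ⊥ᵖ : Pure
  _≃_   : Expr → Expr → Pure
  ¬ᵖ_   : Pure → Pure
  _∧ᵖ_ _∨ᵖ_ _⇒ᵖ_ : Pure → Pure → Pure

⟦_⟧ₚ : Pure → Stack → Bool
⟦ ⊤ᵖ ⟧ₚ s = true
⟦ ⊥ᵖ ⟧ₚ s = false
⟦ e ≃ f ⟧ₚ s = ⌊ ⟦ e ⟧ₑ s ℤ.≟ ⟦ f ⟧ₑ s ⌋
⟦ ¬ᵖ p ⟧ₚ s = not (⟦ p ⟧ₚ s)
⟦ p ∧ᵖ q ⟧ₚ s = ⟦ p ⟧ₚ s ∧ ⟦ q ⟧ₚ s
⟦ p ∨ᵖ q ⟧ₚ s = ⟦ p ⟧ₚ s ∨ ⟦ q ⟧ₚ s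
⟦ p ⇒ᵖ q ⟧ₚ s = not (⟦ p ⟧ₚ s) ∨ ⟦ q ⟧ₚ s

_⊨ₚ_ : Stack → Pure → Set
s ⊨ₚ Π = ⟦ Π ⟧ₚ s ≡ true

Heap : Set
Heap = ℤ → Maybe ℤ

EmptyHeap : Heap → Set
EmptyHeap h = ∀ a → h a ≡ nothing

_≡_∗_ : Heap → Heap → Heap → Set
h ≡ h₁ ∗ h₂ = ∀ a → (h₁ a ≡ nothing × h a ≡ h₂ a) ⊎ (h₂ a ≡ nothing × h a ≡ h₁ a)

Singleton : Heap → ℤ → ℤ → Set
Singleton h a b = h a ≡ just b × (∀ k → k ≢ a → h k ≡ nothing)

Cells : (n : ℕ) → (Fin (suc n) → ℤ) → Heap → Set
Cells zero    a h = EmptyHeap h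
Cells (suc n) a h = ∃[ h₁ ] ∃[ h₂ ] (h ≡ h₁ ∗ h₂ × Singleton h₁ (a fzero) (a (fsuc fzero))
                                     × Cells n (λ i → a (fsuc i)) h₂)

-- Spatial predicates and spatial conjunctions (finite multisets,
-- represented as lists; S ∈ Σ via _∈_, Σ ∖ S via removal _─_).

data Spatial : Set where
  emp  : Spatial
  next : Expr → Expr → Spatial
  lseg : Expr → Expr → Spatial

SpConj : Set
SpConj = List Spatial

∣_∣ : SpConj → ℕ
∣ Σ ∣ = length Σ

_,_⊨ₛ_ : Stack → Heap → Spatial → Set
s , h ⊨ₛ emp = EmptyHeap h
s , h ⊨ₛ next x y = Singleton h (⟦ x ⟧ₑ s) (⟦ y ⟧ₑ s)
s , h ⊨ₛ lseg x z =
  ∃[ n ] ∃[ a ] (a fzero ≡ ⟦ x ⟧ₑ s × a (fromℕ n) ≡ ⟦ z ⟧ₑ s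
                 × (∀ (i : Fin n) → a (inject₁ i) ≢ ⟦ z ⟧ₑ s) × Cells n a h)

_,_⊨_ : Stack → Heap → SpConj → Set
s , h ⊨ [] = EmptyHeap h
s , h ⊨ (S ∷ Σ) = ∃[ h₁ ] ∃[ h₂ ] (h ≡ h₁ ∗ h₂ × s , h₁ ⊨ₛ S × s , h₂ ⊨ Σ)

ValidEntailment : Pure → SpConj → SpConj → Set
ValidEntailment U Σ Σ' = ∀ (s : Stack) (h : Heap) → s ⊨ₚ U → s , h ⊨ Σ → s , h ⊨ Σ'

Empty : Spatial → Pure
Empty emp = ⊤ᵖ
Empty (next x y) = ⊥ᵖ
Empty (lseg x y) = x ≃ y

-- Addr is only meaningful for next/lseg; the value for emp is never
-- relevant since it only occurs guarded by ¬Empty(emp) = ⊥.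
Addr : Spatial → Expr
Addr emp = const (ℤ.+ 0)
Addr (next x _) = x
Addr (lseg x _) = x

Collide : Spatial → Spatial → Pure
Collide emp _ = ⊥ᵖ
Collide _ emp = ⊥ᵖ
Collide S S' = (¬ᵖ Empty S) ∧ᵖ ((¬ᵖ Empty S') ∧ᵖ (Addr S ≃ Addr S'))

WellFormed : SpConj → Pure
WellFormed [] = ⊤ᵖ
WellFormed (S ∷ Σ) = noCollide Σ ∧ᵖ WellFormed Σ
  where
  noCollide : SpConj → Pure
  noCollide [] = ⊤ᵖ
  noCollide (S' ∷ Σ') = (¬ᵖ Collide S S') ∧ᵖ noCollide Σ'

Alloc : SpConj → Expr → Pure
Alloc [] x = ⊥ᵖ
Alloc (S ∷ Σ) x = ((¬ᵖ Empty S) ∧ᵖ (x ≃ Addr S)) ∨ᵖ Alloc Σ x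

Update : Spatial → Spatial → Spatial
Update (next x y) (next x' z) = emp
Update (next x y) (lseg x' z) = lseg y z
Update (lseg x y) (next x' z) = emp
Update (lseg x y) (lseg x' z) = lseg y z
Update _ _ = emp

Check : SpConj → Spatial → Spatial → Pure
Check Σ̂ (next x y) (next x' z) = y ≃ z
Check Σ̂ (next x y) (lseg x' z) = ⊤ᵖ
Check Σ̂ (lseg x y) (next x' z) = ⊥ᵖ
Check Σ̂ (lseg x y) (lseg x' z) = (¬ᵖ (y ≃ z)) ⇒ᵖ Alloc Σ̂ z
Check Σ̂ _ _ = ⊥ᵖ

Guard : SpConj → Spatial → Spatial → Pure
Guard Σ̂ emp S' = ⊥ᵖ
Guard Σ̂ S emp = ⊥ᵖ
Guard Σ̂ S S' = Collide S S' ∧ᵖ Check Σ̂ S S'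

-- The nondeterministic procedure Match(s, Σ̂, Σ, Σ').
-- One recursive step:  Step s Σ̂ Σ Σ' φ Σ₁ Σ₁'  means Match(s,Σ̂,Σ,Σ')
-- may return  φ ∧ Match(s,Σ̂,Σ₁,Σ₁').

Case1 : Stack → SpConj → Set
Case1 s Σ = ∃[ S ] (S ∈ Σ × s ⊨ₚ Empty S)

Case3 : Stack → SpConj → SpConj → SpConj → Set
Case3 s Σ̂ Σ Σ' = ∃[ S ] ∃[ S' ] (S ∈ Σ × S' ∈ Σ' × s ⊨ₚ Guard Σ̂ S S')

data Step (s : Stack) (Σ̂ : SpConj) : SpConj → SpConj → Pure → SpConj → SpConj → Set where
  step1 : ∀ {Σ Σ' S} (p : S ∈ Σ) → s ⊨ₚ Empty S →
          Step s Σ̂ Σ Σ' (Empty S) (Σ ─ p) Σ'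
  step2 : ∀ {Σ Σ' S'} → ¬ Case1 s Σ → (p' : S' ∈ Σ') → s ⊨ₚ Empty S' →
          Step s Σ̂ Σ Σ' (Empty S') Σ (Σ' ─ p')
  step3 : ∀ {Σ Σ' S S'} → ¬ Case1 s Σ → ¬ Case1 s Σ' →
          (p : S ∈ Σ) (p' : S' ∈ Σ') → s ⊨ₚ Guard Σ̂ S S' →
          Step s Σ̂ Σ Σ' (Guard Σ̂ S S') (Σ ─ p) (Update S S' ∷ (Σ' ─ p'))

-- Case 4 applies: none of cases 1–3 applies.
Final : Stack → SpConj → SpConj → SpConj → Set
Final s Σ̂ Σ Σ' = ¬ Case1 s Σ × ¬ Case1 s Σ' × ¬ Case3 s Σ̂ Σ Σ'

finalResult : SpConj → SpConj → Pure
finalResult [] [] = ⊤ᵖ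
finalResult _  _  = ⊥ᵖ

data Run (s : Stack) (Σ̂ : SpConj) : SpConj → SpConj → Pure → ℕ → Set where
  done : ∀ {Σ Σ'} → Final s Σ̂ Σ Σ' → Run s Σ̂ Σ Σ' (finalResult Σ Σ') zero
  more : ∀ {Σ Σ' φ Σ₁ Σ₁' U k} → Step s Σ̂ Σ Σ' φ Σ₁ Σ₁' →
         Run s Σ̂ Σ₁ Σ₁' U k → Run s Σ̂ Σ Σ' (φ ∧ᵖ U) (suc k)

data Steps (s : Stack) (Σ̂ : SpConj) : ℕ → SpConj → SpConj → SpConj → SpConj → Set where
  here  : ∀ {Σ Σ'} → Steps s Σ̂ zero Σ Σ' Σ Σ'
  there : ∀ {k Σ Σ' φ Σ₁ Σ₁' Σ₂ Σ₂'} → Step s Σ̂ Σ Σ' φ Σ₁ Σ₁' →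
          Steps s Σ̂ k Σ₁ Σ₁' Σ₂ Σ₂' → Steps s Σ̂ (suc k) Σ Σ' Σ₂ Σ₂'

-- Termination: every step removes a predicate from Σ or from Σ′ (case 3 removes one from each and
-- adds one to Σ′), so 2|Σ| + |Σ′| decreases, and it bounds the number of steps.
--
-- Soundness is proved along the run, reading each step backwards. The delicate case glues
-- lseg(x,y) ∗ lseg(y,z) into lseg(x,z), which needs z outside the first segment; Check provides
-- y ≃ z or Alloc(Σ̂,z), and the invariant that every address of Σ̂ allocated in the heap belongs
-- to a predicate not yet consumed turns Alloc(Σ̂,z) into exactly that.
--
-- Completeness is proved along the run as well, adding to the countermodel of the recursive call
-- one cell for the predicate consumed by a case-3 step. When the run ends with ⊥, the remaining
-- predicates are nonempty and, by well-formedness, have distinct addresses, so the canonical heap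
-- with one cell a ↦ b per predicate of Σ satisfies Σ; it refutes Σ′ unless some predicate of Σ′
-- collides with one of Σ without a guard. That predicate of Σ is then replaced by a two-cell list
-- x ↦ w ↦ y through a fresh address w, or through the end z of the colliding segment when z is
-- reachable from y: then lseg(x,z) must stop at z, and covering the cell z ↦ y would need a
-- segment trapped on the cycle z → y → … → z.

module Submission where

open import Defs
open import Data.Nat using (ℕ; zero; suc; _+_; _*_; _≤_; _<_; z≤n; s≤s)
open import Data.Nat.Properties
  using (≤-trans; ≤-refl; ≤-pred; n≤1+n; m≤m+n; +-suc; +-mono-≤; +-assoc; +-identityʳ)
open import Data.Bool using (Bool; true; false; _∧_; _∨_; not; _≟_)
open import Data.Maybe using (just; nothing)
open import Data.Maybe.Properties using (just-injective)
open import Data.List using (List; []; _∷_; length; map)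
open import Data.List.Properties using (length-removeAt′)
open import Data.List.Relation.Unary.Any using (Any; here; there; _─_; any?; index)
open import Data.List.Relation.Unary.All using (All; []; _∷_)
import Data.List.Relation.Unary.All as All
open import Data.List.Relation.Unary.All.Properties using (─⁺)
open import Data.List.Relation.Unary.AllPairs using (AllPairs; []; _∷_)
open import Data.List.Relation.Binary.Subset.Propositional using (_⊆_)
open import Data.List.Membership.Propositional using (_∈_; _∉_; find; lose)
open import Data.List.Membership.Propositional.Properties using (∈-map⁺)
open import Data.Fin using (Fin; fromℕ; inject₁) renaming (zero to fzero; suc to fsuc)
open import Data.Product using (Σ; ∃-syntax; _×_; _,_; proj₁; proj₂)
open import Data.Sum using (_⊎_; inj₁; inj₂)
open import Data.Empty using (⊥; ⊥-elim)
open import Relation.Nullary using (¬_; Dec; yes; no; ⌊_⌋)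
open import Relation.Nullary.Decidable using (map′; _×-dec_)
open import Relation.Binary.PropositionalEquality
open import Data.Integer as ℤ using (ℤ)
open import Data.Integer.Properties using (<-irrefl; suc[i]≤j⇒i<j; ≤-totalOrder)
open import Data.List.Extrema ≤-totalOrder using (max; xs≤max)

_⊭ₚ_ : Stack → Pure → Set
s ⊭ₚ Π = ⟦ Π ⟧ₚ s ≡ false

⊨ₚ-or-⊭ₚ : ∀ s Π → s ⊨ₚ Π ⊎ s ⊭ₚ Π
⊨ₚ-or-⊭ₚ s Π with ⟦ Π ⟧ₚ s
... | true  = inj₁ refl
... | false = inj₂ refl

≡false⇒≢true : ∀ {b : Bool} → b ≡ false → b ≢ true
≡false⇒≢true refl ()

∧-true⁻ : ∀ {a b} → a ∧ b ≡ true → a ≡ true × b ≡ true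
∧-true⁻ {true} b≡true = refl , b≡true

∧-true⁺ : ∀ {a b} → a ≡ true → b ≡ true → a ∧ b ≡ true
∧-true⁺ refl refl = refl

∧-false⁻ : ∀ {a b} → a ∧ b ≡ false → a ≡ true → b ≡ false
∧-false⁻ b≡false refl = b≡false

∨-true⁻ : ∀ {a b} → a ∨ b ≡ true → a ≡ true ⊎ b ≡ true
∨-true⁻ {true}  _ = inj₁ refl
∨-true⁻ {false} b≡true = inj₂ b≡true

∨-false⁻ : ∀ {a b} → a ∨ b ≡ false → a ≡ false × b ≡ false
∨-false⁻ {false} b≡false = refl , b≡false

not-true⁻ : ∀ {a} → not a ≡ true → a ≡ false
not-true⁻ {false} _ = refl

not-false⁻ : ∀ {a} → not a ≡ false → a ≡ true
not-false⁻ {true} _ = refl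

≟-true⁻ : ∀ {a b : ℤ} → ⌊ a ℤ.≟ b ⌋ ≡ true → a ≡ b
≟-true⁻ {a} {b} _ with yes a≡b ← a ℤ.≟ b = a≡b

≟-true⁺ : ∀ {a b : ℤ} → a ≡ b → ⌊ a ℤ.≟ b ⌋ ≡ true
≟-true⁺ {a} {b} a≡b with a ℤ.≟ b
... | yes _  = refl
... | no a≢b = ⊥-elim (a≢b a≡b)

≟-false⁺ : ∀ {a b : ℤ} → a ≢ b → ⌊ a ℤ.≟ b ⌋ ≡ false
≟-false⁺ {a} {b} a≢b with a ℤ.≟ b
... | yes a≡b = ⊥-elim (a≢b a≡b)
... | no _    = refl

≟-false⁻ : ∀ {a b : ℤ} → ⌊ a ℤ.≟ b ⌋ ≡ false → a ≢ b
≟-false⁻ {a} {b} _ with no a≢b ← a ℤ.≟ b = a≢b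

infix 4 _≈ₕ_ _⊆ₕ_

_≈ₕ_ : Heap → Heap → Set
g ≈ₕ h = ∀ a → g a ≡ h a

_⊆ₕ_ : Heap → Heap → Set
g ⊆ₕ h = ∀ a v → g a ≡ just v → h a ≡ just v

Allocated : Heap → ℤ → Set
Allocated h a = ∃[ v ] h a ≡ just v

Disjoint : Heap → Heap → Set
Disjoint g h = ∀ a → g a ≡ nothing ⊎ h a ≡ nothing

∅ₕ : Heap
∅ₕ _ = nothing

infixr 6 _∪ₕ_

_∪ₕ_ : Heap → Heap → Heap
(g ∪ₕ h) a with g a
... | just v  = just v
... | nothing = h a

⟨_↦_⟩ : ℤ → ℤ → Heap
⟨ a ↦ b ⟩ k with k ℤ.≟ a
... | yes _ = just b
... | no _  = nothing

⟨_↦_↦_⟩ : ℤ → ℤ → ℤ → Heap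
⟨ a ↦ b ↦ c ⟩ = ⟨ a ↦ b ⟩ ∪ₕ ⟨ b ↦ c ⟩

module _ {h h₁ h₂ : Heap} where

  ∗-comm : h ≡ h₁ ∗ h₂ → h ≡ h₂ ∗ h₁
  ∗-comm h=h₁∗h₂ a with h=h₁∗h₂ a
  ... | inj₁ x = inj₂ x
  ... | inj₂ x = inj₁ x

  ∗-⊆ˡ : h ≡ h₁ ∗ h₂ → h₁ ⊆ₕ h
  ∗-⊆ˡ h=h₁∗h₂ a v h₁a with h=h₁∗h₂ a
  ... | inj₁ (h₁a′ , _) with () ← trans (sym h₁a) h₁a′
  ... | inj₂ (_ , ha) = trans ha h₁a

  ∗-disjointʳ : ∀ {a v} → h ≡ h₁ ∗ h₂ → h₁ a ≡ just v → h₂ a ≡ nothing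
  ∗-disjointʳ {a} h=h₁∗h₂ h₁a with h=h₁∗h₂ a
  ... | inj₁ (h₁a′ , _) with () ← trans (sym h₁a) h₁a′
  ... | inj₂ (h₂a , _) = h₂a

  ∗-unallocatedˡ : ∀ {a} → h ≡ h₁ ∗ h₂ → h a ≡ nothing → h₁ a ≡ nothing
  ∗-unallocatedˡ {a} h=h₁∗h₂ ha with h=h₁∗h₂ a
  ... | inj₁ (h₁a , _) = h₁a
  ... | inj₂ (_ , ha′) = trans (sym ha′) ha

  ∗-unallocated : ∀ {a} → h ≡ h₁ ∗ h₂ → h₁ a ≡ nothing → h₂ a ≡ nothing → h a ≡ nothing
  ∗-unallocated {a} h=h₁∗h₂ h₁a h₂a with h=h₁∗h₂ a
  ... | inj₁ (_ , ha) = trans ha h₂a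
  ... | inj₂ (_ , ha) = trans ha h₁a

  ∗-allocated : ∀ {a v} → h ≡ h₁ ∗ h₂ → h a ≡ just v → h₁ a ≡ just v ⊎ h₂ a ≡ just v
  ∗-allocated {a} h=h₁∗h₂ ha with h=h₁∗h₂ a
  ... | inj₁ (_ , ha′) = inj₂ (trans (sym ha′) ha)
  ... | inj₂ (_ , ha′) = inj₁ (trans (sym ha′) ha)

  ∗-identityˡ : EmptyHeap h₁ → h ≡ h₁ ∗ h₂ → h ≈ₕ h₂
  ∗-identityˡ h₁-empty h=h₁∗h₂ a with h=h₁∗h₂ a
  ... | inj₁ (_ , ha) = ha
  ... | inj₂ (h₂a , ha) = trans ha (trans (h₁-empty a) (sym h₂a))

  ∗-congˡ : ∀ {h′} → h ≈ₕ h′ → h ≡ h₁ ∗ h₂ → h′ ≡ h₁ ∗ h₂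
  ∗-congˡ h≈h′ h=h₁∗h₂ a with h=h₁∗h₂ a
  ... | inj₁ (p , q) = inj₁ (p , trans (sym (h≈h′ a)) q)
  ... | inj₂ (p , q) = inj₂ (p , trans (sym (h≈h′ a)) q)

∗-unallocatedʳ : ∀ {h h₁ h₂ a} → h ≡ h₁ ∗ h₂ → h a ≡ nothing → h₂ a ≡ nothing
∗-unallocatedʳ h=h₁∗h₂ = ∗-unallocatedˡ (∗-comm h=h₁∗h₂)

∗-⊆ʳ : ∀ {h h₁ h₂} → h ≡ h₁ ∗ h₂ → h₂ ⊆ₕ h
∗-⊆ʳ h=h₁∗h₂ = ∗-⊆ˡ (∗-comm h=h₁∗h₂)

∅-∗ : ∀ {h e} → EmptyHeap e → h ≡ e ∗ h
∅-∗ e-empty a = inj₁ (e-empty a , refl)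

∪-∗ : ∀ {g h} → Disjoint g h → (g ∪ₕ h) ≡ g ∗ h
∪-∗ {g} {h} g#h a with g a | g#h a
... | just v  | inj₂ ha = inj₂ (ha , refl)
... | nothing | _       = inj₁ (refl , refl)

∪-allocated : ∀ {g h a v} → (g ∪ₕ h) a ≡ just v → g a ≡ just v ⊎ h a ≡ just v
∪-allocated {g} {h} {a} e with g a
... | just _  = inj₁ e
... | nothing = inj₂ e

disjoint-from : ∀ {g h} → (∀ a v → g a ≡ just v → h a ≡ nothing) → Disjoint g h
disjoint-from {g} f a with g a in ga
... | nothing = inj₁ refl
... | just v  = inj₂ (f a v ga)

⊆ₕ-trans : ∀ {f g h} → f ⊆ₕ g → g ⊆ₕ h → f ⊆ₕ h
⊆ₕ-trans f⊆g g⊆h a v fa = g⊆h a v (f⊆g a v fa)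

∗-assoc : ∀ {h h₁ h₂₃ h₂ h₃} → h ≡ h₁ ∗ h₂₃ → h₂₃ ≡ h₂ ∗ h₃ →
          ∃[ h₁₂ ] (h₁₂ ≡ h₁ ∗ h₂ × h ≡ h₁₂ ∗ h₃)
∗-assoc {h} {h₁} {h₂₃} {h₂} {h₃} sp sp′ = h₁ ∪ₕ h₂ , ∪-∗ h₁#h₂ , split
  where
  h₁#h₂ : Disjoint h₁ h₂
  h₁#h₂ a with sp a
  ... | inj₁ (h₁a , _) = inj₁ h₁a
  ... | inj₂ (h₂₃a , _) = inj₂ (∗-unallocatedˡ sp′ h₂₃a)
  split : h ≡ (h₁ ∪ₕ h₂) ∗ h₃
  split a with h₁ a in h₁a | sp a | sp′ a
  ... | just _  | inj₂ (h₂₃a , ha) | _ = inj₂ (∗-unallocatedʳ sp′ h₂₃a , ha)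
  ... | nothing | inj₁ (_ , ha) | inj₁ (p , q) = inj₁ (p , trans ha q)
  ... | nothing | inj₁ (_ , ha) | inj₂ (p , q) = inj₂ (p , trans ha q)
  ... | nothing | inj₂ (h₂₃a , ha) | _ =
    inj₁ (∗-unallocatedˡ sp′ h₂₃a , trans ha (sym (∗-unallocatedʳ sp′ h₂₃a)))

∗-assoc⁻ : ∀ {h h₁₂ h₁ h₂ h₃} → h ≡ h₁₂ ∗ h₃ → h₁₂ ≡ h₁ ∗ h₂ →
           ∃[ h₂₃ ] (h₂₃ ≡ h₂ ∗ h₃ × h ≡ h₁ ∗ h₂₃)
∗-assoc⁻ sp sp′ with h₂₃ , p , q ← ∗-assoc (∗-comm sp) (∗-comm sp′) = h₂₃ , ∗-comm p , ∗-comm q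

∗-swap : ∀ {h h₁ h₂ h₃ h₂₃} → h ≡ h₁ ∗ h₂₃ → h₂₃ ≡ h₂ ∗ h₃ →
         ∃[ h₁₃ ] (h₁₃ ≡ h₁ ∗ h₃ × h ≡ h₂ ∗ h₁₃)
∗-swap sp sp′ with h₁₂ , p , q ← ∗-assoc sp sp′ = ∗-assoc⁻ q (∗-comm p)

∗-cancelˡ : ∀ {h g g′ k k′} → h ≡ g ∗ k → h ≡ g′ ∗ k′ → g ≈ₕ g′ → k ≈ₕ k′
∗-cancelˡ sp sp′ g≈g′ a with sp a | sp′ a
... | inj₁ (_ , p) | inj₁ (_ , q) = trans (sym p) q
... | inj₁ (ga , p) | inj₂ (k′a , q) = trans (sym p) (trans q (trans (sym (g≈g′ a)) (trans ga (sym k′a))))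
... | inj₂ (ka , p) | inj₁ (g′a , q) = trans ka (sym (trans (sym q) (trans p (trans (g≈g′ a) g′a))))
... | inj₂ (ka , _) | inj₂ (k′a , _) = trans ka (sym k′a)

⟨↦⟩-singleton : ∀ a b → Singleton ⟨ a ↦ b ⟩ a b
⟨↦⟩-singleton a b = at-a , elsewhere
  where
  at-a : ⟨ a ↦ b ⟩ a ≡ just b
  at-a with a ℤ.≟ a
  ... | yes _ = refl
  ... | no a≢a = ⊥-elim (a≢a refl)
  elsewhere : ∀ k → k ≢ a → ⟨ a ↦ b ⟩ k ≡ nothing
  elsewhere k k≢a with k ℤ.≟ a
  ... | yes k≡a = ⊥-elim (k≢a k≡a)
  ... | no _ = refl

singleton-unique : ∀ {c c′ a b} → Singleton c a b → Singleton c′ a b → c ≈ₕ c′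
singleton-unique {a = a} (ca , c-rest) (c′a , c′-rest) k with k ℤ.≟ a
... | yes refl = trans ca (sym c′a)
... | no k≢a = trans (c-rest k k≢a) (sym (c′-rest k k≢a))

singleton-dom : ∀ {c a b k v} → Singleton c a b → c k ≡ just v → k ≡ a
singleton-dom {a = a} {k = k} (_ , c-rest) ck with k ℤ.≟ a
... | yes k≡a = k≡a
... | no k≢a with () ← trans (sym ck) (c-rest k k≢a)

⟨↦⟩-dom : ∀ {a b k v} → ⟨ a ↦ b ⟩ k ≡ just v → k ≡ a
⟨↦⟩-dom = singleton-dom (⟨↦⟩-singleton _ _)

⟨↦⟩-elsewhere : ∀ {a b k} → k ≢ a → ⟨ a ↦ b ⟩ k ≡ nothing
⟨↦⟩-elsewhere {a} {b} {k} = proj₂ (⟨↦⟩-singleton a b) k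

⟨↦⟩-disjoint : ∀ {a b c d} → a ≢ c → Disjoint ⟨ a ↦ b ⟩ ⟨ c ↦ d ⟩
⟨↦⟩-disjoint a≢c = disjoint-from (λ k v e → ⟨↦⟩-elsewhere (λ k≡c → a≢c (trans (sym (⟨↦⟩-dom e)) k≡c)))

⟨↦↦⟩-dom : ∀ {a b c k v} → ⟨ a ↦ b ↦ c ⟩ k ≡ just v → k ≡ a ⊎ k ≡ b
⟨↦↦⟩-dom {a} {b} e with ∪-allocated {⟨ a ↦ b ⟩} e
... | inj₁ e′ = inj₁ (⟨↦⟩-dom e′)
... | inj₂ e′ = inj₂ (⟨↦⟩-dom e′)

⟨↦↦⟩-first : ∀ {a b c} → a ≢ b → ⟨ a ↦ b ↦ c ⟩ a ≡ just b
⟨↦↦⟩-first {a} {b} a≢b = ∗-⊆ˡ (∪-∗ (⟨↦⟩-disjoint a≢b)) a b (proj₁ (⟨↦⟩-singleton a b))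

-- List segments

data LSeg : ℤ → ℤ → Heap → Set where
  nil  : ∀ {a z h} → a ≡ z → EmptyHeap h → LSeg a z h
  cons : ∀ {a b z h h₁ h₂} → a ≢ z → h ≡ h₁ ∗ h₂ → Singleton h₁ a b → LSeg b z h₂ → LSeg a z h

Cells⇒LSeg : ∀ {x z h} n (a : Fin (suc n) → ℤ) → a fzero ≡ x → a (fromℕ n) ≡ z →
             (∀ (i : Fin n) → a (inject₁ i) ≢ z) → Cells n a h → LSeg x z h
Cells⇒LSeg zero    a refl a₀≡z _ cells = nil a₀≡z cells
Cells⇒LSeg (suc n) a refl aₙ≡z aᵢ≢z (_ , _ , split , cell , cells) =
  cons (aᵢ≢z fzero) split cell (Cells⇒LSeg n (λ i → a (fsuc i)) refl aₙ≡z (λ i → aᵢ≢z (fsuc i)) cells)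

LSeg⇒Cells : ∀ {x z h} → LSeg x z h → ∃[ n ] ∃[ a ] (a fzero ≡ x × a (fromℕ n) ≡ z
              × (∀ (i : Fin n) → a (inject₁ i) ≢ z) × Cells n a h)
LSeg⇒Cells {x} (nil x≡z empty) = zero , (λ _ → x) , refl , x≡z , (λ ()) , empty
LSeg⇒Cells {x} {z} (cons x≢z split (hx , rest) seg)
  with n , a , a₀≡b , aₙ≡z , aᵢ≢z , cells ← LSeg⇒Cells seg =
  suc n , a′ , refl , aₙ≡z , a′ᵢ≢z , (_ , _ , split , (subst (λ b → _ ≡ just b) (sym a₀≡b) hx , rest) , cells)
  where
  a′ : Fin (suc (suc n)) → ℤ
  a′ fzero = x
  a′ (fsuc i) = a i
  a′ᵢ≢z : ∀ (i : Fin (suc n)) → a′ (inject₁ i) ≢ z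
  a′ᵢ≢z fzero = x≢z
  a′ᵢ≢z (fsuc i) = aᵢ≢z i

⊨lseg⇒LSeg : ∀ {s h} x z → s , h ⊨ₛ lseg x z → LSeg (⟦ x ⟧ₑ s) (⟦ z ⟧ₑ s) h
⊨lseg⇒LSeg _ _ (n , a , a₀≡x , aₙ≡z , aᵢ≢z , cells) = Cells⇒LSeg n a a₀≡x aₙ≡z aᵢ≢z cells

LSeg⇒⊨lseg : ∀ {s h} x z → LSeg (⟦ x ⟧ₑ s) (⟦ z ⟧ₑ s) h → s , h ⊨ₛ lseg x z
LSeg⇒⊨lseg _ _ = LSeg⇒Cells

LSeg-cong : ∀ {a z h h′} → h ≈ₕ h′ → LSeg a z h → LSeg a z h′
LSeg-cong h≈h′ (nil a≡z empty) = nil a≡z (λ k → trans (sym (h≈h′ k)) (empty k))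
LSeg-cong h≈h′ (cons a≢z split cell seg) = cons a≢z (∗-congˡ h≈h′ split) cell seg

LSeg-end : ∀ {a z h} → LSeg a z h → h z ≡ nothing
LSeg-end (nil _ empty) = empty _
LSeg-end {z = z} (cons a≢z split (_ , rest) seg) =
  ∗-unallocated split (rest z (λ z≡a → a≢z (sym z≡a))) (LSeg-end seg)

LSeg-head : ∀ {a z h} → a ≢ z → LSeg a z h → Allocated h a
LSeg-head a≢z (nil a≡z _) = ⊥-elim (a≢z a≡z)
LSeg-head _ (cons _ split (ha , _) _) = _ , ∗-⊆ˡ split _ _ ha

⟨↦⟩-LSeg : ∀ {a b} → a ≢ b → LSeg a b ⟨ a ↦ b ⟩
⟨↦⟩-LSeg {a} {b} a≢b = cons a≢b (λ _ → inj₂ (refl , refl)) (⟨↦⟩-singleton a b) (nil refl (λ _ → refl))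

⟨↦↦⟩-LSeg : ∀ {a b c} → a ≢ b → b ≢ c → a ≢ c → LSeg a c ⟨ a ↦ b ↦ c ⟩
⟨↦↦⟩-LSeg a≢b b≢c a≢c = cons a≢c (∪-∗ (⟨↦⟩-disjoint a≢b)) (⟨↦⟩-singleton _ _) (⟨↦⟩-LSeg b≢c)

-- The first segment must not pass through z, which would end the combined segment early.
LSeg-++ : ∀ {x y z g₁ g₂ h} → LSeg x y g₁ → LSeg y z g₂ → h ≡ g₁ ∗ g₂ → g₁ z ≡ nothing → LSeg x z h
LSeg-++ (nil refl empty) seg₂ split _ = LSeg-cong (λ a → sym (∗-identityˡ empty split a)) seg₂
LSeg-++ {x} {z = z} {g₁} (cons {b = b} _ split₁ cell seg₁) seg₂ split g₁z
  with k , k-split , h-split ← ∗-assoc⁻ split split₁ =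
  cons x≢z h-split cell (LSeg-++ seg₁ seg₂ k-split (∗-unallocatedʳ split₁ g₁z))
  where
  x≢z : x ≢ z
  x≢z refl with () ← trans (sym (∗-⊆ˡ split₁ x b (proj₁ cell))) g₁z

LSeg-avoids : ∀ {H : Heap} {P : ℤ → Set} → (∀ v → P v → ∃[ w ] (H v ≡ just w × P w)) →
              ∀ {a b k} → ¬ P b → k ⊆ₕ H → LSeg a b k → ∀ c → P c → k c ≡ nothing
LSeg-avoids closed ¬Pb k⊆H (nil _ empty) c _ = empty c
LSeg-avoids {H} {P} closed ¬Pb k⊆H (cons {a} {a₁} _ split (ka , rest) seg) c Pc with c ℤ.≟ a
... | no c≢a = ∗-unallocated split (rest c c≢a) (LSeg-avoids closed ¬Pb (⊆ₕ-trans (∗-⊆ʳ split) k⊆H) seg c Pc)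
... | yes refl with w , Hc , Pw ← closed c Pc
  with refl ← just-injective (trans (sym (k⊆H c a₁ (∗-⊆ˡ split c a₁ ka))) Hc) | seg
...   | nil a₁≡b _ = ⊥-elim (¬Pb (subst P a₁≡b Pw))
...   | seg@(cons _ split′ (h₂a₁ , _) _)
  with () ← trans (sym (∗-⊆ˡ split′ _ _ h₂a₁)) (LSeg-avoids closed ¬Pb (⊆ₕ-trans (∗-⊆ʳ split) k⊆H) seg a₁ Pw)

∈-─⁻ : ∀ {A : Set} {x y : A} {xs} (p : x ∈ xs) → y ∈ (xs ─ p) → y ∈ xs
∈-─⁻ (here refl) q = there q
∈-─⁻ (there p) (here y≡x) = here y≡x
∈-─⁻ (there p) (there q) = there (∈-─⁻ p q)

∈-─-split : ∀ {A : Set} {x y : A} {xs} (p : x ∈ xs) → y ∈ xs → y ≡ x ⊎ y ∈ (xs ─ p)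
∈-─-split (here refl) (here refl) = inj₁ refl
∈-─-split (here refl) (there q) = inj₂ q
∈-─-split (there p) (here refl) = inj₂ (here refl)
∈-─-split (there p) (there q) with ∈-─-split p q
... | inj₁ y≡x = inj₁ y≡x
... | inj₂ q′ = inj₂ (there q′)

⊨-cong : ∀ {s h h′} Σ → h ≈ₕ h′ → s , h ⊨ Σ → s , h′ ⊨ Σ
⊨-cong [] h≈h′ empty a = trans (sym (h≈h′ a)) (empty a)
⊨-cong (S ∷ Σ) h≈h′ (h₁ , h₂ , split , sat₁ , sat₂) = h₁ , h₂ , ∗-congˡ h≈h′ split , sat₁ , sat₂

⊨-extract : ∀ {s h S Σ} (p : S ∈ Σ) → s , h ⊨ Σ → s , h ⊨ (S ∷ (Σ ─ p))
⊨-extract (here refl) sat = sat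
⊨-extract (there p) (h₁ , h₂ , split , sat₁ , sat₂)
  with g₁ , g₂ , split′ , satS , satR ← ⊨-extract p sat₂
  with k , k-split , h-split ← ∗-swap split split′ =
  g₁ , k , h-split , satS , (h₁ , g₂ , k-split , sat₁ , satR)

⊨-insert : ∀ {s h S Σ} (p : S ∈ Σ) → s , h ⊨ (S ∷ (Σ ─ p)) → s , h ⊨ Σ
⊨-insert (here refl) sat = sat
⊨-insert (there p) (g₁ , k , split , satS , (h₁ , g₂ , split′ , sat₁ , satR))
  with k′ , k′-split , h-split ← ∗-swap split split′ =
  h₁ , k′ , h-split , sat₁ , ⊨-insert p (g₁ , g₂ , k′-split , satS , satR)

⊨-cover : ∀ {s h a v} Σ → s , h ⊨ Σ → h a ≡ just v →
          ∃[ T ] (T ∈ Σ × ∃[ k ] (k ⊆ₕ h × s , k ⊨ₛ T × k a ≡ just v))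
⊨-cover [] empty ha with () ← trans (sym ha) (empty _)
⊨-cover {a = a} (S ∷ Σ) (h₁ , h₂ , split , sat₁ , sat₂) ha with ∗-allocated split ha
... | inj₁ h₁a = S , here refl , h₁ , ∗-⊆ˡ split , sat₁ , h₁a
... | inj₂ h₂a with T , T∈Σ , k , k⊆h₂ , satT , ka ← ⊨-cover Σ sat₂ h₂a =
  T , there T∈Σ , k , ⊆ₕ-trans k⊆h₂ (∗-⊆ʳ split) , satT , ka

NonEmpty : Stack → Spatial → Set
NonEmpty s S = s ⊭ₚ Empty S

addr : Stack → Spatial → ℤ
addr s S = ⟦ Addr S ⟧ₑ s

-- Like Addr, the value for emp is irrelevant.
Target : Spatial → Expr
Target emp = const (ℤ.+ 0)
Target (next _ y) = y
Target (lseg _ y) = y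

target : Stack → Spatial → ℤ
target s S = ⟦ Target S ⟧ₑ s

cell : Stack → Spatial → Heap
cell s S = ⟨ addr s S ↦ target s S ⟩

IsAddr : Stack → SpConj → ℤ → Set
IsAddr s Σ a = ∃[ T ] (T ∈ Σ × NonEmpty s T × addr s T ≡ a)

IsAddr-⊆ : ∀ {s Σ Σ′ a} → Σ ⊆ Σ′ → IsAddr s Σ a → IsAddr s Σ′ a
IsAddr-⊆ Σ⊆Σ′ (T , T∈Σ , T≠∅ , T≡a) = T , Σ⊆Σ′ T∈Σ , T≠∅ , T≡a

NonEmpty-lseg : ∀ {s} x y → NonEmpty s (lseg x y) → ⟦ x ⟧ₑ s ≢ ⟦ y ⟧ₑ s
NonEmpty-lseg _ _ = ≟-false⁻

Empty⇒⊨ₛ : ∀ {s h} S → s ⊨ₚ Empty S → EmptyHeap h → s , h ⊨ₛ S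
Empty⇒⊨ₛ emp _ empty = empty
Empty⇒⊨ₛ {s} (lseg x y) x≡y empty = LSeg⇒⊨lseg x y (nil (≟-true⁻ x≡y) empty)

⊨ₛ-Empty⇒empty : ∀ {s h} S → s ⊨ₚ Empty S → s , h ⊨ₛ S → EmptyHeap h
⊨ₛ-Empty⇒empty emp _ sat = sat
⊨ₛ-Empty⇒empty (lseg x y) x≡y sat with ⊨lseg⇒LSeg x y sat
... | nil _ empty = empty
... | cons x≢y _ _ _ = ⊥-elim (x≢y (≟-true⁻ x≡y))

⊨ₛ-addr-allocated : ∀ {s h} S → NonEmpty s S → s , h ⊨ₛ S → Allocated h (addr s S)
⊨ₛ-addr-allocated (next x y) _ (hx , _) = _ , hx
⊨ₛ-addr-allocated (lseg x y) x≢y sat = LSeg-head (NonEmpty-lseg x y x≢y) (⊨lseg⇒LSeg x y sat)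

⊨-addr-allocated : ∀ {s h a} Σ → s , h ⊨ Σ → IsAddr s Σ a → Allocated h a
⊨-addr-allocated (S ∷ Σ) (h₁ , h₂ , split , sat₁ , _) (_ , here refl , S≠∅ , refl)
  with v , h₁a ← ⊨ₛ-addr-allocated S S≠∅ sat₁ = v , ∗-⊆ˡ split _ _ h₁a
⊨-addr-allocated (S ∷ Σ) (h₁ , h₂ , split , _ , sat₂) (T , there T∈Σ , T≠∅ , T≡a)
  with v , h₂a ← ⊨-addr-allocated Σ sat₂ (T , T∈Σ , T≠∅ , T≡a) = v , ∗-⊆ʳ split _ _ h₂a

cell-⊨ₛ : ∀ {s} S → NonEmpty s S → s , cell s S ⊨ₛ S
cell-⊨ₛ (next x y) _ = ⟨↦⟩-singleton _ _
cell-⊨ₛ (lseg x y) x≢y = LSeg⇒⊨lseg x y (⟨↦⟩-LSeg (NonEmpty-lseg x y x≢y))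

collide-parts : ∀ {e e′ : Bool} {a b : ℤ} → not e ∧ (not e′ ∧ ⌊ a ℤ.≟ b ⌋) ≡ true →
                e ≡ false × e′ ≡ false × a ≡ b
collide-parts {false} {false} c = refl , refl , ≟-true⁻ c

Collide⁻ : ∀ {s} T T′ → s ⊨ₚ Collide T T′ → NonEmpty s T × NonEmpty s T′ × addr s T ≡ addr s T′
Collide⁻ (next _ _) (next _ _) = collide-parts
Collide⁻ (next _ _) (lseg _ _) = collide-parts
Collide⁻ (lseg _ _) (next _ _) = collide-parts
Collide⁻ (lseg _ _) (lseg _ _) = collide-parts

Collide⁺ : ∀ {s} T T′ → NonEmpty s T → NonEmpty s T′ → addr s T ≡ addr s T′ → s ⊨ₚ Collide T T′
Collide⁺ (next _ _) (next _ _) _   _    T≡T′ rewrite ≟-true⁺ T≡T′ = refl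
Collide⁺ (next _ _) (lseg _ _) _   T′≠∅ T≡T′ rewrite T′≠∅ | ≟-true⁺ T≡T′ = refl
Collide⁺ (lseg _ _) (next _ _) T≠∅ _    T≡T′ rewrite T≠∅ | ≟-true⁺ T≡T′ = refl
Collide⁺ (lseg _ _) (lseg _ _) T≠∅ T′≠∅ T≡T′ rewrite T≠∅ | T′≠∅ | ≟-true⁺ T≡T′ = refl

Alloc⁻ : ∀ {s} Σ e → s ⊨ₚ Alloc Σ e → IsAddr s Σ (⟦ e ⟧ₑ s)
Alloc⁻ (S ∷ Σ) e alloc with ∨-true⁻ alloc
... | inj₁ here-alloc with S≠∅ , e≡S ← ∧-true⁻ here-alloc = S , here refl , not-true⁻ S≠∅ , sym (≟-true⁻ e≡S)
... | inj₂ there-alloc with T , T∈Σ , T≠∅ , T≡e ← Alloc⁻ Σ e there-alloc = T , there T∈Σ , T≠∅ , T≡e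

Alloc-false⁻ : ∀ {s} Σ e → s ⊭ₚ Alloc Σ e → ¬ IsAddr s Σ (⟦ e ⟧ₑ s)
Alloc-false⁻ (S ∷ Σ) e ¬alloc (_ , here refl , S≠∅ , S≡e) =
  ≟-false⁻ (∧-false⁻ (proj₁ (∨-false⁻ ¬alloc)) (cong not S≠∅)) (sym S≡e)
Alloc-false⁻ (S ∷ Σ) e ¬alloc (T , there T∈Σ , T≠∅ , T≡e) =
  Alloc-false⁻ Σ e (proj₂ (∨-false⁻ ¬alloc)) (T , T∈Σ , T≠∅ , T≡e)

Apart : Stack → Spatial → Spatial → Set
Apart s S T = NonEmpty s S → NonEmpty s T → addr s S ≢ addr s T

Apart-sym : ∀ {s} S T → Apart s S T → Apart s T S
Apart-sym _ _ apart T≠∅ S≠∅ T≡S = apart S≠∅ T≠∅ (sym T≡S)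

¬Collide⇒Apart : ∀ {s} S T → s ⊭ₚ Collide S T → Apart s S T
¬Collide⇒Apart S T ¬collide S≠∅ T≠∅ S≡T = ≡false⇒≢true ¬collide (Collide⁺ S T S≠∅ T≠∅ S≡T)

WellFormed-head : ∀ {s} S Σ → s ⊨ₚ WellFormed (S ∷ Σ) → All (Apart s S) Σ
WellFormed-head S [] _ = []
WellFormed-head S (T ∷ Σ) wf
  with no-collision , wf-T∷Σ ← ∧-true⁻ wf
  with S-T , S-Σ ← ∧-true⁻ no-collision =
  ¬Collide⇒Apart S T (not-true⁻ S-T) ∷ WellFormed-head S Σ (∧-true⁺ S-Σ (proj₂ (∧-true⁻ wf-T∷Σ)))

WellFormed⇒Apart : ∀ {s} Σ → s ⊨ₚ WellFormed Σ → AllPairs (Apart s) Σ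
WellFormed⇒Apart [] _ = []
WellFormed⇒Apart (S ∷ Σ) wf = WellFormed-head S Σ wf ∷ WellFormed⇒Apart Σ (proj₂ (∧-true⁻ wf))

AllPairs-─ : ∀ {s S Σ} (p : S ∈ Σ) → AllPairs (Apart s) Σ → AllPairs (Apart s) (Σ ─ p)
AllPairs-─ (here refl) (_ ∷ apart) = apart
AllPairs-─ (there p) (S-apart ∷ apart) = ─⁺ p S-apart ∷ AllPairs-─ p apart

Apart-─ : ∀ {s S T Σ} (p : S ∈ Σ) → AllPairs (Apart s) Σ → T ∈ (Σ ─ p) → Apart s S T
Apart-─ (here refl) (S-apart ∷ _) T∈ = All.lookup S-apart T∈
Apart-─ {S = S} (there {x = U} p) (U-apart ∷ _) (here refl) = Apart-sym U S (All.lookup U-apart p)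
Apart-─ (there p) (_ ∷ apart) (there T∈) = Apart-─ p apart T∈

Guard⁻ : ∀ {s Σ̂} S S′ → s ⊨ₚ Guard Σ̂ S S′ → s ⊨ₚ Collide S S′ × s ⊨ₚ Check Σ̂ S S′
Guard⁻ (next _ _) (next _ _) = ∧-true⁻
Guard⁻ (next _ _) (lseg _ _) = ∧-true⁻
Guard⁻ (lseg _ _) (next _ _) = ∧-true⁻
Guard⁻ (lseg _ _) (lseg _ _) = ∧-true⁻

Guard-false⁻ : ∀ {s Σ̂} S S′ → s ⊨ₚ Collide S S′ → s ⊭ₚ Guard Σ̂ S S′ → s ⊭ₚ Check Σ̂ S S′
Guard-false⁻ (next _ _) (next _ _) = λ c g → ∧-false⁻ g c
Guard-false⁻ (next _ _) (lseg _ _) = λ c g → ∧-false⁻ g c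
Guard-false⁻ (lseg _ _) (next _ _) = λ c g → ∧-false⁻ g c
Guard-false⁻ (lseg _ _) (lseg _ _) = λ c g → ∧-false⁻ g c

Check-lseg⁻ : ∀ {s Σ̂} x y x′ z → s ⊨ₚ Check Σ̂ (lseg x y) (lseg x′ z) →
              ⟦ y ⟧ₑ s ≡ ⟦ z ⟧ₑ s ⊎ IsAddr s Σ̂ (⟦ z ⟧ₑ s)
Check-lseg⁻ {Σ̂ = Σ̂} _ _ _ z check with ∨-true⁻ check
... | inj₁ y≡z = inj₁ (≟-true⁻ (not-false⁻ (not-true⁻ y≡z)))
... | inj₂ alloc = inj₂ (Alloc⁻ Σ̂ z alloc)

Check-lseg-false⁻ : ∀ {s Σ̂} x y x′ z → s ⊭ₚ Check Σ̂ (lseg x y) (lseg x′ z) →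
                    ⟦ y ⟧ₑ s ≢ ⟦ z ⟧ₑ s × ¬ IsAddr s Σ̂ (⟦ z ⟧ₑ s)
Check-lseg-false⁻ {Σ̂ = Σ̂} _ _ _ z ¬check with y≢z , ¬alloc ← ∨-false⁻ ¬check =
  ≟-false⁻ (not-true⁻ (not-false⁻ y≢z)) , Alloc-false⁻ Σ̂ z ¬alloc

-- Termination and the number of steps

case1? : ∀ s Σ → Dec (Case1 s Σ)
case1? s Σ = map′ find (λ (S , S∈Σ , e) → lose S∈Σ e) (any? (λ S → ⟦ Empty S ⟧ₚ s ≟ true) Σ)

case3? : ∀ s Σ̂ Σ Σ′ → Dec (Case3 s Σ̂ Σ Σ′)
case3? s Σ̂ Σ Σ′ = map′ from-any to-any
  (any? (λ S → any? (λ S′ → ⟦ Guard Σ̂ S S′ ⟧ₚ s ≟ true) Σ′) Σ)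
  where
  from-any : Any (λ S → Any (λ S′ → s ⊨ₚ Guard Σ̂ S S′) Σ′) Σ → Case3 s Σ̂ Σ Σ′
  from-any guarded with S , S∈Σ , guarded′ ← find guarded with S′ , S′∈Σ′ , g ← find guarded′ =
    S , S′ , S∈Σ , S′∈Σ′ , g
  to-any : Case3 s Σ̂ Σ Σ′ → Any (λ S → Any (λ S′ → s ⊨ₚ Guard Σ̂ S S′) Σ′) Σ
  to-any (S , S′ , S∈Σ , S′∈Σ′ , g) = lose S∈Σ (lose S′∈Σ′ g)

progress : ∀ s Σ̂ Σ Σ′ → Final s Σ̂ Σ Σ′ ⊎ ∃[ φ ] ∃[ Σ₁ ] ∃[ Σ₁′ ] Step s Σ̂ Σ Σ′ φ Σ₁ Σ₁′
progress s Σ̂ Σ Σ′ with case1? s Σ | case1? s Σ′ | case3? s Σ̂ Σ Σ′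
... | yes (_ , p , e) | _ | _ = inj₂ (_ , _ , _ , step1 p e)
... | no ¬case1 | yes (_ , p′ , e′) | _ = inj₂ (_ , _ , _ , step2 ¬case1 p′ e′)
... | no ¬case1 | no ¬case1′ | yes (_ , _ , p , p′ , g) = inj₂ (_ , _ , _ , step3 ¬case1 ¬case1′ p p′ g)
... | no ¬case1 | no ¬case1′ | no ¬case3 = inj₁ (¬case1 , ¬case1′ , ¬case3)

size : SpConj → SpConj → ℕ
size Σ Σ′ = length Σ + length Σ + length Σ′

size-step : ∀ {s Σ̂ Σ Σ′ φ Σ₁ Σ₁′} → Step s Σ̂ Σ Σ′ φ Σ₁ Σ₁′ → size Σ₁ Σ₁′ < size Σ Σ′
size-step (step1 {Σ} {Σ′} p _) rewrite length-removeAt′ Σ (index p) = shrink-Σ (length (Σ ─ p)) (length Σ′)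
  where
  shrink-Σ : ∀ l l′ → suc (l + l + l′) ≤ suc l + suc l + l′
  shrink-Σ l l′ rewrite +-suc l l = n≤1+n _
size-step (step2 {Σ} {Σ′} _ p′ _) rewrite length-removeAt′ Σ′ (index p′)
  | +-suc (length Σ + length Σ) (length (Σ′ ─ p′)) = ≤-refl
size-step (step3 {Σ} {Σ′} _ _ p p′ _) rewrite length-removeAt′ Σ (index p) | length-removeAt′ Σ′ (index p′)
  | +-suc (length (Σ ─ p)) (length (Σ ─ p)) = n≤1+n _

run : ∀ {s Σ̂} n Σ Σ′ → size Σ Σ′ < n → ∃[ U ] ∃[ k ] Run s Σ̂ Σ Σ′ U k
run {s} {Σ̂} (suc n) Σ Σ′ size<n with progress s Σ̂ Σ Σ′
... | inj₁ final = _ , _ , done final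
... | inj₂ (_ , Σ₁ , Σ₁′ , st) with _ , _ , r ← run n Σ₁ Σ₁′ (≤-trans (size-step st) (≤-pred size<n)) =
  _ , _ , more st r

Run-steps≤size : ∀ {s Σ̂ Σ Σ′ U k} → Run s Σ̂ Σ Σ′ U k → k ≤ size Σ Σ′
Run-steps≤size (done _) = z≤n
Run-steps≤size (more st r) = ≤-trans (s≤s (Run-steps≤size r)) (size-step st)

Steps≤size : ∀ {s Σ̂ k Σ Σ′ Σ₁ Σ₁′} → Steps s Σ̂ k Σ Σ′ Σ₁ Σ₁′ → k ≤ size Σ Σ′
Steps≤size here = z≤n
Steps≤size (there st r) = ≤-trans (s≤s (Steps≤size r)) (size-step st)

size≤linear : ∀ Σ Σ′ → size Σ Σ′ ≤ 2 * (∣ Σ ∣ + ∣ Σ′ ∣) + 2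
size≤linear Σ Σ′ rewrite +-assoc (length Σ) (length Σ) (length Σ′) | +-identityʳ (length Σ + length Σ′) =
  ≤-trans (+-mono-≤ (m≤m+n (length Σ) (length Σ′)) ≤-refl) (m≤m+n _ 2)

-- Soundness

Tracks : Stack → SpConj → SpConj → Heap → Set
Tracks s Σ̂ Σ h = ∀ a → IsAddr s Σ̂ a → Allocated h a → IsAddr s Σ a

IsAddr-─-split : ∀ {s S Σ a} (p : S ∈ Σ) → IsAddr s Σ a → (NonEmpty s S × addr s S ≡ a) ⊎ IsAddr s (Σ ─ p) a
IsAddr-─-split p (T , T∈Σ , T≠∅ , T≡a) with ∈-─-split p T∈Σ
... | inj₁ refl = inj₁ (T≠∅ , T≡a)
... | inj₂ T∈Σ─p = inj₂ (T , T∈Σ─p , T≠∅ , T≡a)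

Tracks-─-empty : ∀ {s Σ̂ S Σ h} (p : S ∈ Σ) → s ⊨ₚ Empty S → Tracks s Σ̂ Σ h → Tracks s Σ̂ (Σ ─ p) h
Tracks-─-empty p S=∅ tracks a a∈Σ̂ a∈h with IsAddr-─-split p (tracks a a∈Σ̂ a∈h)
... | inj₁ (S≠∅ , _) = ⊥-elim (≡false⇒≢true S≠∅ S=∅)
... | inj₂ a∈Σ─p = a∈Σ─p

Tracks-─-split : ∀ {s Σ̂ S Σ h hS hR} (p : S ∈ Σ) → h ≡ hS ∗ hR → s , hS ⊨ₛ S →
                 Tracks s Σ̂ Σ h → Tracks s Σ̂ (Σ ─ p) hR
Tracks-─-split {S = S} p split satS tracks a a∈Σ̂ (v , hRa)
  with IsAddr-─-split p (tracks a a∈Σ̂ (v , ∗-⊆ʳ split a v hRa))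
... | inj₂ a∈Σ─p = a∈Σ─p
... | inj₁ (S≠∅ , refl) with _ , hSa ← ⊨ₛ-addr-allocated S S≠∅ satS
  with () ← trans (sym hRa) (∗-disjointʳ split hSa)

Tracks-free : ∀ {s Σ̂ S Σ h hS hR a} (p : S ∈ Σ) → h ≡ hS ∗ hR → s , hR ⊨ (Σ ─ p) →
              Tracks s Σ̂ Σ h → IsAddr s Σ̂ a → a ≢ addr s S → hS a ≡ nothing
Tracks-free {Σ = Σ} {hS = hS} {a = a} p split satR tracks a∈Σ̂ a≢S with hS a in hSa
... | nothing = refl
... | just v with IsAddr-─-split p (tracks a a∈Σ̂ (v , ∗-⊆ˡ split a v hSa))
...   | inj₁ (_ , S≡a) = ⊥-elim (a≢S (sym S≡a))
...   | inj₂ a∈Σ─p with _ , hRa ← ⊨-addr-allocated (Σ ─ p) satR a∈Σ─p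
  with () ← trans (sym hRa) (∗-disjointʳ split hSa)

Tracks-─-unallocated : ∀ {s Σ̂ S Σ h} (p : S ∈ Σ) → S ∈ Σ̂ → NonEmpty s S → AllPairs (Apart s) Σ →
                       Tracks s Σ̂ (Σ ─ p) h → h (addr s S) ≡ nothing
Tracks-─-unallocated {s} {S = S} {h = h} p S∈Σ̂ S≠∅ apart tracks with h (addr s S) in hS
... | nothing = refl
... | just v with T , T∈R , T≠∅ , T≡S ← tracks _ (S , S∈Σ̂ , S≠∅ , refl) (v , hS) =
  ⊥-elim (Apart-─ p apart T∈R S≠∅ T≠∅ (sym T≡S))

Guard-sound : ∀ {s Σ̂ h hS hU} S S′ → s ⊨ₚ Guard Σ̂ S S′ → h ≡ hS ∗ hU →
              s , hS ⊨ₛ S → s , hU ⊨ₛ Update S S′ →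
              (∀ a → IsAddr s Σ̂ a → a ≢ addr s S → hS a ≡ nothing) → s , h ⊨ₛ S′
Guard-sound {s} {Σ̂} (next x y) (next x′ z) g split (hSx , hS-rest) hU=∅ _
  with collide , y≡z ← Guard⁻ {Σ̂ = Σ̂} (next x y) (next x′ z) g
  with _ , _ , x≡x′ ← Collide⁻ (next x y) (next x′ z) collide =
  subst₂ (Singleton _) x≡x′ (≟-true⁻ y≡z)
    (trans (h≈hS _) hSx , λ k k≢x → trans (h≈hS k) (hS-rest k k≢x))
  where
  h≈hS : _ ≈ₕ _
  h≈hS = ∗-identityˡ hU=∅ (∗-comm split)
Guard-sound {s} {Σ̂} (next x y) (lseg x′ z) g split satS satU _
  with collide , _ ← Guard⁻ {Σ̂ = Σ̂} (next x y) (lseg x′ z) g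
  with _ , x′≢z , x≡x′ ← Collide⁻ (next x y) (lseg x′ z) collide =
  LSeg⇒⊨lseg x′ z (cons (NonEmpty-lseg x′ z x′≢z) split (subst (λ a → Singleton _ a _) x≡x′ satS)
                        (⊨lseg⇒LSeg y z satU))
Guard-sound {Σ̂ = Σ̂} (lseg x y) (next x′ z) g with _ , () ← Guard⁻ {Σ̂ = Σ̂} (lseg x y) (next x′ z) g
Guard-sound {s} {Σ̂} {hS = hS} (lseg x y) (lseg x′ z) g split satS satU free
  with collide , check ← Guard⁻ {Σ̂ = Σ̂} (lseg x y) (lseg x′ z) g
  with _ , x′≢z , x≡x′ ← Collide⁻ (lseg x y) (lseg x′ z) collide =
  LSeg⇒⊨lseg x′ z (subst (λ a → LSeg a _ _) x≡x′ (LSeg-++ segS (⊨lseg⇒LSeg y z satU) split z-free))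
  where
  segS = ⊨lseg⇒LSeg x y satS
  z-free : hS (⟦ z ⟧ₑ s) ≡ nothing
  z-free with Check-lseg⁻ {Σ̂ = Σ̂} x y x′ z check
  ... | inj₁ y≡z = subst (λ a → hS a ≡ nothing) y≡z (LSeg-end segS)
  ... | inj₂ z∈Σ̂ = free _ z∈Σ̂ (λ z≡x → NonEmpty-lseg x′ z x′≢z (trans (sym x≡x′) (sym z≡x)))

sound : ∀ {s Σ̂ Σ Σ′ U k} → Run s Σ̂ Σ Σ′ U k →
        ∀ s′ h → s′ ⊨ₚ U → s′ , h ⊨ Σ → Tracks s′ Σ̂ Σ h → s′ , h ⊨ Σ′
sound (done {[]} {[]} _) _ _ _ sat _ = sat
sound (more (step1 {Σ} {S = S} p _) r) s′ h u sat tracks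
  with hS , hR , split , satS , satR ← ⊨-extract p sat
  with S=∅ , u′ ← ∧-true⁻ u =
  sound r s′ h u′ (⊨-cong (Σ ─ p) (λ a → sym (∗-identityˡ (⊨ₛ-Empty⇒empty S S=∅ satS) split a)) satR)
        (Tracks-─-empty p S=∅ tracks)
sound (more (step2 {S' = S′} _ p′ _) r) s′ h u sat tracks
  with S′=∅ , u′ ← ∧-true⁻ u =
  ⊨-insert p′ (∅ₕ , h , ∅-∗ (λ _ → refl) , Empty⇒⊨ₛ S′ S′=∅ (λ _ → refl) , sound r s′ h u′ sat tracks)
sound (more (step3 {Σ} {S = S} {S' = S′} _ _ p p′ _) r) s′ h u sat tracks
  with g , u′ ← ∧-true⁻ u
  with hS , hR , split , satS , satR ← ⊨-extract p sat
  with hU , hR′ , splitR , satU , satR′ ← sound r s′ hR u′ satR (Tracks-─-split p split satS tracks)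
  with k , k-split , h-split ← ∗-assoc split splitR =
  ⊨-insert p′ (k , hR′ , h-split ,
    Guard-sound S S′ g k-split satS satU (λ _ → Tracks-free p split satR tracks) ,
    satR′)

-- Canonical heaps and reachability

canon : Stack → SpConj → Heap
canon s [] a = nothing
canon s (S ∷ Σ) a with a ℤ.≟ addr s S
... | yes _ = just (target s S)
... | no _  = canon s Σ a

canon-IsAddr : ∀ {s Σ a} → All (NonEmpty s) Σ → Allocated (canon s Σ) a → IsAddr s Σ a
canon-IsAddr {s} {S ∷ Σ} {a} (S≠∅ ∷ Σ≠∅) a∈canon with a ℤ.≟ addr s S
... | yes a≡S = S , here refl , S≠∅ , sym a≡S
... | no _    = IsAddr-⊆ there (canon-IsAddr Σ≠∅ a∈canon)

canon-unallocated : ∀ {s Σ a} → All (NonEmpty s) Σ → ¬ IsAddr s Σ a → canon s Σ a ≡ nothing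
canon-unallocated {s} {Σ} {a} Σ≠∅ a∉Σ with canon s Σ a in canon-a
... | nothing = refl
... | just v  = ⊥-elim (a∉Σ (canon-IsAddr Σ≠∅ (v , canon-a)))

canon-⊨ : ∀ {s Σ} → All (NonEmpty s) Σ → AllPairs (Apart s) Σ → s , canon s Σ ⊨ Σ
canon-⊨ {Σ = []} _ _ _ = refl
canon-⊨ {s} {S ∷ Σ} (S≠∅ ∷ Σ≠∅) (S-apart ∷ apart) =
  cell s S , canon s Σ , split , cell-⊨ₛ S S≠∅ , canon-⊨ Σ≠∅ apart
  where
  split : canon s (S ∷ Σ) ≡ cell s S ∗ canon s Σ
  split a with a ℤ.≟ addr s S
  ... | no a≢S = inj₁ (refl , refl)
  ... | yes refl = inj₂ (canon-unallocated Σ≠∅ S∉Σ , refl)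
    where
    S∉Σ : ¬ IsAddr s Σ (addr s S)
    S∉Σ (T , T∈Σ , T≠∅ , T≡S) = All.lookup S-apart T∈Σ S≠∅ T≠∅ (sym T≡S)

canon-Tracks : ∀ {s Σ̂ Σ} → All (NonEmpty s) Σ → Tracks s Σ̂ Σ (canon s Σ)
canon-Tracks Σ≠∅ _ _ a∈canon = canon-IsAddr Σ≠∅ a∈canon

data Path (H : Heap) : ℤ → ℤ → Set where
  stop : ∀ {z} → Path H z z
  step : ∀ {v w z} → H v ≡ just w → Path H w z → Path H v z

Path-mono : ∀ {H H′ v z} → H ⊆ₕ H′ → Path H v z → Path H′ v z
Path-mono H⊆H′ stop = stop
Path-mono H⊆H′ (step Hv p) = step (H⊆H′ _ _ Hv) (Path-mono H⊆H′ p)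

dropAt : Stack → ℤ → SpConj → SpConj
dropAt s a [] = []
dropAt s a (S ∷ Σ) with a ℤ.≟ addr s S
... | yes _ = dropAt s a Σ
... | no _  = S ∷ dropAt s a Σ

canon-dropAt-≢ : ∀ {s a b} Σ → b ≢ a → canon s (dropAt s a Σ) b ≡ canon s Σ b
canon-dropAt-≢ [] _ = refl
canon-dropAt-≢ {s} {a} {b} (S ∷ Σ) b≢a with a ℤ.≟ addr s S | b ℤ.≟ addr s S
... | yes a≡S | yes b≡S = ⊥-elim (b≢a (trans b≡S (sym a≡S)))
... | yes _   | no _    = canon-dropAt-≢ Σ b≢a
... | no _    | yes b≡S with b ℤ.≟ addr s S
...   | yes _ = refl
...   | no b≢S = ⊥-elim (b≢S b≡S)
canon-dropAt-≢ {s} {a} {b} (S ∷ Σ) b≢a | no _ | no b≢S with b ℤ.≟ addr s S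
...   | yes b≡S = ⊥-elim (b≢S b≡S)
...   | no _ = canon-dropAt-≢ Σ b≢a

canon-dropAt-≡ : ∀ {s a} Σ → canon s (dropAt s a Σ) a ≡ nothing
canon-dropAt-≡ [] = refl
canon-dropAt-≡ {s} {a} (S ∷ Σ) with a ℤ.≟ addr s S
... | yes _ = canon-dropAt-≡ Σ
... | no a≢S with a ℤ.≟ addr s S
...   | yes a≡S = ⊥-elim (a≢S a≡S)
...   | no _ = canon-dropAt-≡ Σ

canon-dropAt-⊆ : ∀ {s a} Σ → canon s (dropAt s a Σ) ⊆ₕ canon s Σ
canon-dropAt-⊆ {a = a} Σ b v e with b ℤ.≟ a
... | yes refl with () ← trans (sym e) (canon-dropAt-≡ Σ)
... | no b≢a = trans (sym (canon-dropAt-≢ Σ b≢a)) e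

length-dropAt≤ : ∀ {s a} Σ → length (dropAt s a Σ) ≤ length Σ
length-dropAt≤ [] = z≤n
length-dropAt≤ {s} {a} (S ∷ Σ) with a ℤ.≟ addr s S
... | yes _ = ≤-trans (length-dropAt≤ Σ) (n≤1+n _)
... | no _  = s≤s (length-dropAt≤ Σ)

length-dropAt< : ∀ {s a v} Σ → canon s Σ a ≡ just v → suc (length (dropAt s a Σ)) ≤ length Σ
length-dropAt< {s} {a} (S ∷ Σ) e with a ℤ.≟ addr s S
... | yes _ = s≤s (length-dropAt≤ Σ)
... | no _  = s≤s (length-dropAt< Σ e)

-- Dropping the visited cell bounds the search by the length of Σ.
reaches : Stack → ℕ → SpConj → ℤ → ℤ → Bool
reaches s zero Σ v z = ⌊ v ℤ.≟ z ⌋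
reaches s (suc n) Σ v z with v ℤ.≟ z | canon s Σ v
... | yes _ | _       = true
... | no _  | nothing = false
... | no _  | just w  = reaches s n (dropAt s v Σ) w z

reaches-sound : ∀ {s} n Σ v z → reaches s n Σ v z ≡ true → Path (canon s Σ) v z
reaches-sound zero Σ v z r rewrite ≟-true⁻ r = stop
reaches-sound {s} (suc n) Σ v z r with v ℤ.≟ z | canon s Σ v in canon-v
... | yes refl | _ = stop
... | no _ | just w = step canon-v (Path-mono (canon-dropAt-⊆ Σ) (reaches-sound n (dropAt s v Σ) w z r))

reaches-complete : ∀ {s v z r} n Σ → LSeg v z r → r ⊆ₕ canon s Σ → length Σ ≤ n → reaches s n Σ v z ≡ true
reaches-complete zero Σ (nil v≡z _) _ _ = ≟-true⁺ v≡z
reaches-complete {v = v} {z} (suc n) Σ (nil v≡z _) _ _ with v ℤ.≟ z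
... | yes _ = refl
... | no v≢z = ⊥-elim (v≢z v≡z)
reaches-complete {v = v} zero Σ (cons {b = b} _ split (rv , _) _) r⊆canon |Σ|≤0
  with () ← ≤-trans (length-dropAt< Σ (r⊆canon v b (∗-⊆ˡ split v b rv))) |Σ|≤0
reaches-complete {s} {v} {z} (suc n) Σ (cons {b = b} v≢z split (rv , _) seg) r⊆canon |Σ|≤1+n
  with shorter ← ≤-pred (≤-trans (length-dropAt< Σ (r⊆canon v b (∗-⊆ˡ split v b rv))) |Σ|≤1+n)
  with v ℤ.≟ z | canon s Σ v | r⊆canon v b (∗-⊆ˡ split v b rv)
... | yes v≡z | _ | _ = ⊥-elim (v≢z v≡z)
... | no _ | just _ | refl = reaches-complete n (dropAt s v Σ) seg rest⊆ shorter
  where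
  rest⊆ : _ ⊆ₕ canon s (dropAt s v Σ)
  rest⊆ a u e with a ℤ.≟ v
  ... | yes refl with () ← trans (sym e) (∗-disjointʳ split rv)
  ... | no a≢v = trans (canon-dropAt-≢ Σ a≢v) (r⊆canon a u (∗-⊆ʳ split a u e))

-- Completeness

record Countermodel (s : Stack) (Σ̂ Σ Σ′ : SpConj) : Set where
  constructor mkCountermodel
  field
    heap      : Heap
    satisfies : s , heap ⊨ Σ
    refutes   : ¬ (s , heap ⊨ Σ′)
    tracks    : Tracks s Σ̂ Σ heap

fresh : (as : List ℤ) → ∃[ w ] (w ∉ as)
fresh as = ℤ.suc (max (ℤ.+ 0) as) , λ w∈as → <-irrefl refl (suc[i]≤j⇒i<j (All.lookup (xs≤max _ as) w∈as))

∉-addrs⇒¬IsAddr : ∀ {s Σ a} → a ∉ map (addr s) Σ → ¬ IsAddr s Σ a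
∉-addrs⇒¬IsAddr {s} a∉ (T , T∈Σ , _ , T≡a) = a∉ (subst (_∈ _) T≡a (∈-map⁺ (addr s) T∈Σ))

IsAddr? : ∀ s Σ a → Dec (IsAddr s Σ a)
IsAddr? s Σ a = map′ find (λ (T , T∈Σ , T≠∅ , T≡a) → lose T∈Σ (T≠∅ , T≡a))
  (any? (λ T → (⟦ Empty T ⟧ₚ s ≟ false) ×-dec (addr s T ℤ.≟ a)) Σ)

¬Case1⇒NonEmpty : ∀ {s Σ} → ¬ Case1 s Σ → All (NonEmpty s) Σ
¬Case1⇒NonEmpty {s} {Σ} ¬case1 = All.tabulate nonEmpty
  where
  nonEmpty : ∀ {T} → T ∈ Σ → NonEmpty s T
  nonEmpty {T} T∈Σ with ⊨ₚ-or-⊭ₚ s (Empty T)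
  ... | inj₁ T=∅ = ⊥-elim (¬case1 (T , T∈Σ , T=∅))
  ... | inj₂ T≠∅ = T≠∅

¬Case3⇒Guard-false : ∀ {s Σ̂ Σ Σ′ S S′} → ¬ Case3 s Σ̂ Σ Σ′ → S ∈ Σ → S′ ∈ Σ′ → s ⊭ₚ Guard Σ̂ S S′
¬Case3⇒Guard-false {s} {Σ̂} {S = S} {S′} ¬case3 S∈Σ S′∈Σ′ with ⊨ₚ-or-⊭ₚ s (Guard Σ̂ S S′)
... | inj₁ g = ⊥-elim (¬case3 (S , S′ , S∈Σ , S′∈Σ′ , g))
... | inj₂ ¬g = ¬g

-- Only an lseg/lseg pair can collide without a guard, and then its Check fails.
¬Case3⇒lseg-end-fresh : ∀ {s Σ̂ Σ Σ′} a b → ¬ Case3 s Σ̂ Σ Σ′ → lseg a b ∈ Σ′ → NonEmpty s (lseg a b) →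
                        IsAddr s Σ (⟦ a ⟧ₑ s) → ¬ IsAddr s Σ̂ (⟦ b ⟧ₑ s)
¬Case3⇒lseg-end-fresh a b ¬case3 ab∈Σ′ ab≠∅ (T , T∈Σ , T≠∅ , T≡a)
  with ¬check ← Guard-false⁻ T (lseg a b) (Collide⁺ T (lseg a b) T≠∅ ab≠∅ T≡a)
                               (¬Case3⇒Guard-false ¬case3 T∈Σ ab∈Σ′)
  with T
... | next _ _ with () ← ¬check
... | lseg c d = proj₂ (Check-lseg-false⁻ c d a b ¬check)

⊨-∷-empty⁻ : ∀ {s h} S Σ → s ⊨ₚ Empty S → s , h ⊨ (S ∷ Σ) → s , h ⊨ Σ
⊨-∷-empty⁻ S Σ S=∅ (h₁ , _ , split , satS , satΣ) =
  ⊨-cong Σ (λ a → sym (∗-identityˡ (⊨ₛ-Empty⇒empty S S=∅ satS) split a)) satΣ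

peel-lseg : ∀ {s H h Σ} x y z → H ≡ ⟨ ⟦ x ⟧ₑ s ↦ ⟦ y ⟧ₑ s ⟩ ∗ h → NonEmpty s (lseg x z) →
            s , H ⊨ (lseg x z ∷ Σ) → s , h ⊨ (lseg y z ∷ Σ)
peel-lseg x y z H-split xz≠∅ (h₁ , h₂ , split , satL , satΣ) with ⊨lseg⇒LSeg x z satL
... | nil x≡z _ = ⊥-elim (NonEmpty-lseg x z xz≠∅ x≡z)
... | cons _ split₁ (c₁x , c₁-rest) seg
  with k , k-split , H-split′ ← ∗-assoc⁻ split split₁
  with refl ← just-injective (trans (sym (∗-⊆ˡ H-split′ _ _ c₁x)) (∗-⊆ˡ H-split _ _ (proj₁ (⟨↦⟩-singleton _ _)))) =
  _ , h₂ , ∗-congˡ (λ a → sym (h≈k a)) k-split , LSeg⇒⊨lseg y z seg , satΣ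
  where
  h≈k : _ ≈ₕ k
  h≈k = ∗-cancelˡ H-split H-split′ (singleton-unique (⟨↦⟩-singleton _ _) (c₁x , c₁-rest))

next-refute : ∀ {s H Σ a v} x z → H a ≡ just v → ⟦ x ⟧ₑ s ≡ a → v ≢ ⟦ z ⟧ₑ s → ¬ (s , H ⊨ (next x z ∷ Σ))
next-refute x z Ha refl v≢z (_ , _ , split , (h₁x , _) , _) =
  v≢z (just-injective (trans (sym Ha) (∗-⊆ˡ split _ _ h₁x)))

Guard-complete : ∀ {s Σ̂ H h Σ} S S′ → s ⊨ₚ Guard Σ̂ S S′ → H ≡ cell s S ∗ h →
                 s , H ⊨ (S′ ∷ Σ) → s , h ⊨ (Update S S′ ∷ Σ)
Guard-complete {Σ̂ = Σ̂} {Σ = Σ} (next x y) (next x′ z) g H-split (h₁ , h₂ , split , sat₁ , sat₂)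
  with collide , y≡z ← Guard⁻ {Σ̂ = Σ̂} (next x y) (next x′ z) g
  with _ , _ , x≡x′ ← Collide⁻ (next x y) (next x′ z) collide =
  ∅ₕ , _ , ∅-∗ (λ _ → refl) , (λ _ → refl) , ⊨-cong Σ (λ a → sym (h≈h₂ a)) sat₂
  where
  h≈h₂ : _ ≈ₕ h₂
  h≈h₂ = ∗-cancelˡ H-split split
    (singleton-unique (⟨↦⟩-singleton _ _) (subst₂ (Singleton h₁) (sym x≡x′) (sym (≟-true⁻ y≡z)) sat₁))
Guard-complete {Σ̂ = Σ̂} (next x y) (lseg x′ z) g H-split
  with collide , _ ← Guard⁻ {Σ̂ = Σ̂} (next x y) (lseg x′ z) g
  with _ , xz≠∅ , x≡x′ ← Collide⁻ (next x y) (lseg x′ z) collide =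
  peel-lseg x′ y z (subst (λ a → _ ≡ ⟨ a ↦ _ ⟩ ∗ _) x≡x′ H-split) xz≠∅
Guard-complete {Σ̂ = Σ̂} (lseg x y) (next x′ z) g with _ , () ← Guard⁻ {Σ̂ = Σ̂} (lseg x y) (next x′ z) g
Guard-complete {Σ̂ = Σ̂} (lseg x y) (lseg x′ z) g H-split
  with collide , _ ← Guard⁻ {Σ̂ = Σ̂} (lseg x y) (lseg x′ z) g
  with _ , xz≠∅ , x≡x′ ← Collide⁻ (lseg x y) (lseg x′ z) collide =
  peel-lseg x′ y z (subst (λ a → _ ≡ ⟨ a ↦ _ ⟩ ∗ _) x≡x′ H-split) xz≠∅

uncoverable-cycle : ∀ {s R T′ k} {y z : ℤ} → All (NonEmpty s) R → k ≡ ⟨ z ↦ y ⟩ ∗ canon s R →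
  Path (canon s R) y z → ¬ IsAddr s T′ z →
  (∀ a b → lseg a b ∈ T′ → NonEmpty s (lseg a b) → IsAddr s R (⟦ a ⟧ₑ s) → ¬ IsAddr s R (⟦ b ⟧ₑ s)) →
  ¬ (s , k ⊨ T′)
uncoverable-cycle {s} {R} {T′} {k} {y} {z} R≠∅ split y→z z∉T′ lseg-end-fresh sat
  with T , T∈T′ , k′ , k′⊆k , satT , k′z ← ⊨-cover T′ sat (∗-⊆ˡ split z y (proj₁ (⟨↦⟩-singleton z y))) =
  uncovered T T∈T′ k′⊆k satT k′z
  where
  kz : k z ≡ just y
  kz = ∗-⊆ˡ split z y (proj₁ (⟨↦⟩-singleton z y))
  k-dom : ∀ {a} → Allocated k a → a ≡ z ⊎ IsAddr s R a
  k-dom (v , ka) with ∗-allocated split ka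
  ... | inj₁ e = inj₁ (⟨↦⟩-dom e)
  ... | inj₂ e = inj₂ (canon-IsAddr R≠∅ (v , e))
  closed : ∀ v → Path k v z → ∃[ w ] (k v ≡ just w × Path k w z)
  closed _ stop = y , kz , Path-mono (∗-⊆ʳ split) y→z
  closed _ (step kv v→z) = _ , kv , v→z
  unreachable : ∀ {c} → c ≢ z → ¬ IsAddr s R c → ¬ Path k c z
  unreachable c≢z _ stop = c≢z refl
  unreachable c≢z c∉R (step kc _) with k-dom (_ , kc)
  ... | inj₁ c≡z = c≢z c≡z
  ... | inj₂ c∈R = c∉R c∈R
  uncovered : ∀ T → T ∈ T′ → ∀ {k′} → k′ ⊆ₕ k → s , k′ ⊨ₛ T → k′ z ≡ just y → ⊥
  uncovered emp _ _ empty k′z with () ← trans (sym k′z) (empty z)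
  uncovered (next a b) T∈T′ _ cell k′z = z∉T′ (next a b , T∈T′ , refl , sym (singleton-dom cell k′z))
  uncovered (lseg a b) T∈T′ {k′} k′⊆k satT k′z with ⊨lseg⇒LSeg a b satT
  ... | nil _ empty with () ← trans (sym k′z) (empty z)
  ... | seg@(cons a≢b _ _ _) with v , k′a ← LSeg-head a≢b seg with k-dom (v , k′⊆k _ v k′a)
  ...   | inj₁ a≡z = z∉T′ (lseg a b , T∈T′ , ≟-false⁺ a≢b , a≡z)
  ...   | inj₂ a∈R with ⟦ b ⟧ₑ s ℤ.≟ z
  ...     | yes b≡z with () ← trans (sym k′z) (subst (λ c → k′ c ≡ nothing) b≡z (LSeg-end seg))
  ...     | no b≢z with () ← trans (sym k′z) (LSeg-avoids closed
                              (unreachable b≢z (lseg-end-fresh a b T∈T′ (≟-false⁺ a≢b) a∈R)) k′⊆k seg z stop)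

-- A heap for S that can be joined with the canonical heap of the other predicates of Σ.
Patch : Stack → SpConj → Spatial → Heap → Set
Patch s Σ̂ S g = s , g ⊨ₛ S × (∀ a → Allocated g a → a ≡ addr s S ⊎ ¬ IsAddr s Σ̂ a)

cell-Patch : ∀ {s Σ̂} S → NonEmpty s S → Patch s Σ̂ S (cell s S)
cell-Patch S S≠∅ = cell-⊨ₛ S S≠∅ , λ _ (_ , e) → inj₁ (⟨↦⟩-dom e)

two-cell-Patch : ∀ {s Σ̂} x y (w : ℤ) → ⟦ x ⟧ₑ s ≢ w → w ≢ ⟦ y ⟧ₑ s → NonEmpty s (lseg x y) →
                 ¬ IsAddr s Σ̂ w → Patch s Σ̂ (lseg x y) ⟨ ⟦ x ⟧ₑ s ↦ w ↦ ⟦ y ⟧ₑ s ⟩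
two-cell-Patch x y w x≢w w≢y xy≠∅ w∉Σ̂ = LSeg⇒⊨lseg x y (⟨↦↦⟩-LSeg x≢w w≢y (NonEmpty-lseg x y xy≠∅)) , dom
  where
  dom : ∀ a → Allocated ⟨ ⟦ x ⟧ₑ _ ↦ w ↦ ⟦ y ⟧ₑ _ ⟩ a → a ≡ ⟦ x ⟧ₑ _ ⊎ ¬ IsAddr _ _ a
  dom a (_ , e) with ⟨↦↦⟩-dom {⟦ x ⟧ₑ _} {w} {⟦ y ⟧ₑ _} e
  ... | inj₁ a≡x = inj₁ a≡x
  ... | inj₂ refl = inj₂ w∉Σ̂

Patch-extend : ∀ {s Σ̂ S Σ g h} (p : S ∈ Σ) → NonEmpty s S → Patch s Σ̂ S g → Disjoint g h →
               s , h ⊨ (Σ ─ p) → Tracks s Σ̂ (Σ ─ p) h → s , (g ∪ₕ h) ⊨ Σ × Tracks s Σ̂ Σ (g ∪ₕ h)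
Patch-extend {s} {Σ̂} {S} {Σ} {g} {h} p S≠∅ (satS , g-dom) g#h sat tracks =
  ⊨-insert p (_ , _ , ∪-∗ g#h , satS , sat) , tracks′
  where
  tracks′ : Tracks s Σ̂ Σ (g ∪ₕ h)
  tracks′ a a∈Σ̂ (v , e) with ∪-allocated {g} {h} e
  ... | inj₂ ha = IsAddr-⊆ (∈-─⁻ p) (tracks a a∈Σ̂ (v , ha))
  ... | inj₁ ga with g-dom a (v , ga)
  ...   | inj₁ refl = S , p , S≠∅ , refl
  ...   | inj₂ a∉Σ̂ = ⊥-elim (a∉Σ̂ a∈Σ̂)

patched-countermodel : ∀ {s Σ̂ S Σ Σ′ g} (p : S ∈ Σ) → All (NonEmpty s) Σ → AllPairs (Apart s) Σ → Σ ⊆ Σ̂ →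
                       Patch s Σ̂ S g → (∀ {H} → H ≡ g ∗ canon s (Σ ─ p) → ¬ (s , H ⊨ Σ′)) →
                       Countermodel s Σ̂ Σ Σ′
patched-countermodel {s} {Σ̂} {S} {Σ} {g = g} p Σ≠∅ apart Σ⊆Σ̂ patch refute =
  let sat , tracks = Patch-extend p (All.lookup Σ≠∅ p) patch g#B
                                 (canon-⊨ R≠∅ (AllPairs-─ p apart)) (canon-Tracks R≠∅)
  in mkCountermodel _ sat (refute (∪-∗ g#B)) tracks
  where
  R≠∅ = ─⁺ p Σ≠∅
  g#B : Disjoint g (canon s (Σ ─ p))
  g#B = disjoint-from λ a v ga → canon-unallocated R≠∅ (a∉R a (proj₂ patch a (v , ga)))
    where
    a∉R : ∀ a → a ≡ addr s S ⊎ ¬ IsAddr s Σ̂ a → ¬ IsAddr s (Σ ─ p) a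
    a∉R _ (inj₁ refl) (T , T∈R , T≠∅ , T≡S) = Apart-─ p apart T∈R (All.lookup Σ≠∅ p) T≠∅ (sym T≡S)
    a∉R _ (inj₂ a∉Σ̂) a∈R = a∉Σ̂ (IsAddr-⊆ (λ T∈R → Σ⊆Σ̂ (∈-─⁻ p T∈R)) a∈R)

module LsegCollision {s Σ̂ Σ T′} (x y x′ z : Expr) (p : lseg x y ∈ Σ) (x≡x′ : ⟦ x ⟧ₑ s ≡ ⟦ x′ ⟧ₑ s)
  (xy≠∅ : NonEmpty s (lseg x y)) (xz≠∅ : NonEmpty s (lseg x′ z)) (y≢z : ⟦ y ⟧ₑ s ≢ ⟦ z ⟧ₑ s)
  (z∉Σ̂ : ¬ IsAddr s Σ̂ (⟦ z ⟧ₑ s)) (Σ≠∅ : All (NonEmpty s) Σ) (¬case3 : ¬ Case3 s Σ̂ Σ (lseg x′ z ∷ T′))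
  (Σ⊆Σ̂ : Σ ⊆ Σ̂) (apart : AllPairs (Apart s) Σ) where

  private
    R = Σ ─ p
    B = canon s R
    R≠∅ = ─⁺ p Σ≠∅
    x≢z : ⟦ x ⟧ₑ s ≢ ⟦ z ⟧ₑ s
    x≢z x≡z = NonEmpty-lseg x′ z xz≠∅ (trans (sym x≡x′) x≡z)
    z∉R : ¬ IsAddr s R (⟦ z ⟧ₑ s)
    z∉R z∈R = z∉Σ̂ (IsAddr-⊆ (λ T∈R → Σ⊆Σ̂ (∈-─⁻ p T∈R)) z∈R)

    patch₁ : Patch s Σ̂ (lseg x y) (cell s (lseg x y))
    patch₁ = cell-Patch (lseg x y) xy≠∅

    patch₂ : Patch s Σ̂ (lseg x y) ⟨ ⟦ x ⟧ₑ s ↦ ⟦ z ⟧ₑ s ↦ ⟦ y ⟧ₑ s ⟩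
    patch₂ = two-cell-Patch x y (⟦ z ⟧ₑ s) x≢z (λ z≡y → y≢z (sym z≡y)) xy≠∅ z∉Σ̂

    from-x′ : ∀ {H h v} → H ≡ ⟨ ⟦ x ⟧ₑ s ↦ v ⟩ ∗ h → H ≡ ⟨ ⟦ x′ ⟧ₑ s ↦ v ⟩ ∗ h
    from-x′ = subst (λ a → _ ≡ ⟨ a ↦ _ ⟩ ∗ _) x≡x′

    refute₁-owned : IsAddr s T′ (⟦ z ⟧ₑ s) → ∀ {H} → H ≡ ⟨ ⟦ x ⟧ₑ s ↦ ⟦ y ⟧ₑ s ⟩ ∗ B →
                    ¬ (s , H ⊨ (lseg x′ z ∷ T′))
    refute₁-owned z∈T′ split sat with _ , Hz ← ⊨-addr-allocated (lseg x′ z ∷ T′) sat (IsAddr-⊆ there z∈T′)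
      with () ← trans (sym Hz) (∗-unallocated split (⟨↦⟩-elsewhere (λ z≡x → x≢z (sym z≡x)))
                                                 (canon-unallocated R≠∅ z∉R))

    refute₁-unreachable : reaches s (length R) R (⟦ y ⟧ₑ s) (⟦ z ⟧ₑ s) ≡ false →
                          ∀ {H} → H ≡ ⟨ ⟦ x ⟧ₑ s ↦ ⟦ y ⟧ₑ s ⟩ ∗ B → ¬ (s , H ⊨ (lseg x′ z ∷ T′))
    refute₁-unreachable unreachable split sat
      with _ , _ , split′ , satL , _ ← peel-lseg x′ y z (from-x′ split) xz≠∅ sat =
      ≡false⇒≢true unreachable (reaches-complete (length R) R (⊨lseg⇒LSeg y z satL) (∗-⊆ˡ split′) ≤-refl)

    refute₂ : ¬ IsAddr s T′ (⟦ z ⟧ₑ s) → reaches s (length R) R (⟦ y ⟧ₑ s) (⟦ z ⟧ₑ s) ≡ true →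
              ∀ {H} → H ≡ ⟨ ⟦ x ⟧ₑ s ↦ ⟦ z ⟧ₑ s ↦ ⟦ y ⟧ₑ s ⟩ ∗ B → ¬ (s , H ⊨ (lseg x′ z ∷ T′))
    refute₂ z∉T′ reachable split sat
      with k , k-split , H-split ← ∗-assoc⁻ split (∪-∗ (⟨↦⟩-disjoint x≢z)) =
      uncoverable-cycle R≠∅ k-split (reaches-sound (length R) R _ _ reachable) z∉T′ lseg-end-fresh
        (⊨-∷-empty⁻ (lseg z z) T′ (≟-true⁺ refl) (peel-lseg x′ z z (from-x′ H-split) xz≠∅ sat))
      where
      lseg-end-fresh : ∀ a b → lseg a b ∈ T′ → NonEmpty s (lseg a b) →
                       IsAddr s R (⟦ a ⟧ₑ s) → ¬ IsAddr s R (⟦ b ⟧ₑ s)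
      lseg-end-fresh a b ab∈T′ ab≠∅ a∈R b∈R =
        ¬Case3⇒lseg-end-fresh a b ¬case3 (there ab∈T′) ab≠∅ (IsAddr-⊆ (∈-─⁻ p) a∈R)
          (IsAddr-⊆ (λ T∈R → Σ⊆Σ̂ (∈-─⁻ p T∈R)) b∈R)

  countermodel : Countermodel s Σ̂ Σ (lseg x′ z ∷ T′)
  countermodel with IsAddr? s T′ (⟦ z ⟧ₑ s) | reaches s (length R) R (⟦ y ⟧ₑ s) (⟦ z ⟧ₑ s) in reach
  ... | yes z∈T′ | _     = patched-countermodel p Σ≠∅ apart Σ⊆Σ̂ patch₁ (refute₁-owned z∈T′)
  ... | no _     | false = patched-countermodel p Σ≠∅ apart Σ⊆Σ̂ patch₁ (refute₁-unreachable reach)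
  ... | no z∉T′  | true  = patched-countermodel p Σ≠∅ apart Σ⊆Σ̂ patch₂ (refute₂ z∉T′ reach)

collision-countermodel : ∀ {s Σ̂ Σ T′} S S′ (p : S ∈ Σ) → s ⊨ₚ Collide S S′ → All (NonEmpty s) Σ →
                         ¬ Case3 s Σ̂ Σ (S′ ∷ T′) → Σ ⊆ Σ̂ → AllPairs (Apart s) Σ →
                         Countermodel s Σ̂ Σ (S′ ∷ T′)
collision-countermodel {Σ̂ = Σ̂} (next x y) (next x′ z) p collide Σ≠∅ ¬case3 Σ⊆Σ̂ apart =
  let ¬check = Guard-false⁻ {Σ̂ = Σ̂} (next x y) (next x′ z) collide (¬Case3⇒Guard-false ¬case3 p (here refl))
      xy≠∅ , _ , x≡x′ = Collide⁻ (next x y) (next x′ z) collide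
  in patched-countermodel p Σ≠∅ apart Σ⊆Σ̂ (cell-Patch (next x y) xy≠∅) λ split →
       next-refute x′ z (∗-⊆ˡ split _ _ (proj₁ (⟨↦⟩-singleton _ _))) (sym x≡x′) (≟-false⁻ ¬check)
collision-countermodel {Σ̂ = Σ̂} (next x y) (lseg x′ z) p collide _ ¬case3 _ _
  with () ← Guard-false⁻ {Σ̂ = Σ̂} (next x y) (lseg x′ z) collide (¬Case3⇒Guard-false ¬case3 p (here refl))
collision-countermodel {s} {Σ̂} (lseg x y) (next x′ z) p collide Σ≠∅ ¬case3 Σ⊆Σ̂ apart =
  let xy≠∅ , _ , x≡x′ = Collide⁻ (lseg x y) (next x′ z) collide
      w , w∉ = fresh (⟦ x ⟧ₑ s ∷ ⟦ y ⟧ₑ s ∷ ⟦ z ⟧ₑ s ∷ map (addr s) Σ̂)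
      x≢w = λ x≡w → w∉ (here (sym x≡w))
      w∉Σ̂ = ∉-addrs⇒¬IsAddr (λ w∈Σ̂ → w∉ (there (there (there w∈Σ̂))))
      w≢y = λ w≡y → w∉ (there (here w≡y))
      w≢z = λ w≡z → w∉ (there (there (here w≡z)))
  in patched-countermodel p Σ≠∅ apart Σ⊆Σ̂ (two-cell-Patch x y w x≢w w≢y xy≠∅ w∉Σ̂) λ split →
       next-refute x′ z (∗-⊆ˡ split _ _ (⟨↦↦⟩-first x≢w)) (sym x≡x′) w≢z
collision-countermodel {Σ̂ = Σ̂} (lseg x y) (lseg x′ z) p collide Σ≠∅ ¬case3 Σ⊆Σ̂ apart =
  let ¬check = Guard-false⁻ {Σ̂ = Σ̂} (lseg x y) (lseg x′ z) collide (¬Case3⇒Guard-false ¬case3 p (here refl))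
      xy≠∅ , xz≠∅ , x≡x′ = Collide⁻ (lseg x y) (lseg x′ z) collide
      y≢z , z∉Σ̂ = Check-lseg-false⁻ {Σ̂ = Σ̂} x y x′ z ¬check
  in LsegCollision.countermodel x y x′ z p x≡x′ xy≠∅ xz≠∅ y≢z z∉Σ̂ Σ≠∅ ¬case3 Σ⊆Σ̂ apart

final-countermodel : ∀ {s Σ̂ Σ Σ′} → Final s Σ̂ Σ Σ′ → s ⊭ₚ finalResult Σ Σ′ → Σ ⊆ Σ̂ →
                     AllPairs (Apart s) Σ → Countermodel s Σ̂ Σ Σ′
final-countermodel {Σ = []} {[]} _ ()
final-countermodel {s} {Σ = S ∷ Σ} {[]} (¬case1 , _) _ _ apart =
  mkCountermodel (canon s (S ∷ Σ)) (canon-⊨ Σ≠∅ apart) refute (canon-Tracks Σ≠∅)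
  where
  Σ≠∅ = ¬Case1⇒NonEmpty ¬case1
  refute : ¬ EmptyHeap (canon s (S ∷ Σ))
  refute empty
    with _ , canon-S ← ⊨-addr-allocated (S ∷ Σ) (canon-⊨ Σ≠∅ apart) (S , here refl , All.lookup Σ≠∅ (here refl) , refl)
    with () ← trans (sym canon-S) (empty (addr s S))
final-countermodel {s} {Σ = Σ} {S′ ∷ T′} (¬case1 , ¬case1′ , ¬case3) _ Σ⊆Σ̂ apart
  with any? (λ T → ⟦ Collide T S′ ⟧ₚ s ≟ true) Σ
... | yes collision with T , T∈Σ , collide ← find collision =
  collision-countermodel T S′ T∈Σ collide (¬Case1⇒NonEmpty ¬case1) ¬case3 Σ⊆Σ̂ apart
... | no ¬collision = mkCountermodel (canon s Σ) (canon-⊨ Σ≠∅ apart) refute (canon-Tracks Σ≠∅)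
  where
  Σ≠∅ = ¬Case1⇒NonEmpty ¬case1
  S′≠∅ = All.lookup (¬Case1⇒NonEmpty ¬case1′) (here refl)
  refute : ¬ (s , canon s Σ ⊨ (S′ ∷ T′))
  refute (_ , _ , split , satS′ , _) with v , S′-alloc ← ⊨ₛ-addr-allocated S′ S′≠∅ satS′
    with T , T∈Σ , T≠∅ , T≡S′ ← canon-IsAddr Σ≠∅ (v , ∗-⊆ˡ split _ _ S′-alloc) =
    ¬collision (lose T∈Σ (Collide⁺ T S′ T≠∅ S′≠∅ T≡S′))

complete : ∀ {s Σ̂ Σ Σ′ U k} → Run s Σ̂ Σ Σ′ U k → s ⊭ₚ U → Σ ⊆ Σ̂ → AllPairs (Apart s) Σ →
           Countermodel s Σ̂ Σ Σ′
complete (done final) ¬u Σ⊆Σ̂ apart = final-countermodel final ¬u Σ⊆Σ̂ apart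
complete (more (step1 {S = S} p S=∅) r) ¬u Σ⊆Σ̂ apart =
  let mkCountermodel h sat ¬sat′ tracks =
        complete r (∧-false⁻ ¬u S=∅) (λ T∈ → Σ⊆Σ̂ (∈-─⁻ p T∈)) (AllPairs-─ p apart)
  in mkCountermodel h (⊨-insert p (∅ₕ , h , ∅-∗ (λ _ → refl) , Empty⇒⊨ₛ S S=∅ (λ _ → refl) , sat)) ¬sat′
       λ a a∈Σ̂ a∈h → IsAddr-⊆ (∈-─⁻ p) (tracks a a∈Σ̂ a∈h)
complete (more (step2 {S' = S′} _ p′ S′=∅) r) ¬u Σ⊆Σ̂ apart =
  let mkCountermodel h sat ¬sat′ tracks = complete r (∧-false⁻ ¬u S′=∅) Σ⊆Σ̂ apart
  in mkCountermodel h sat (λ sat′ → ¬sat′ (⊨-∷-empty⁻ S′ _ S′=∅ (⊨-extract p′ sat′))) tracks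
complete (more (step3 {S = S} {S' = S′} _ _ p p′ g) r) ¬u Σ⊆Σ̂ apart =
  let S≠∅ , _ = Collide⁻ S S′ (proj₁ (Guard⁻ S S′ g))
      mkCountermodel h sat ¬sat′ tracks =
        complete r (∧-false⁻ ¬u g) (λ T∈ → Σ⊆Σ̂ (∈-─⁻ p T∈)) (AllPairs-─ p apart)
      S#h = disjoint-from λ a _ e → subst (λ a → h a ≡ nothing) (sym (⟨↦⟩-dom e))
                                           (Tracks-─-unallocated p (Σ⊆Σ̂ p) S≠∅ apart tracks)
      sat⁺ , tracks⁺ = Patch-extend p S≠∅ (cell-Patch S S≠∅) S#h sat tracks
  in mkCountermodel _ sat⁺ (λ sat′ → ¬sat′ (Guard-complete S S′ g (∪-∗ S#h) (⊨-extract p′ sat′))) tracks⁺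

theorem2 : Σ ℕ λ c → ∀ (Σ₀ Σ₀' : SpConj) (s : Stack) → s ⊨ₚ WellFormed Σ₀ →
      ( ∃[ U ] ∃[ k ] Run s Σ₀ Σ₀ Σ₀' U k )
    × ( ∀ k Σ₁ Σ₁' → Steps s Σ₀ k Σ₀ Σ₀' Σ₁ Σ₁' → k ≤ c * (∣ Σ₀ ∣ + ∣ Σ₀' ∣) + c )
    × ( ∀ U k → Run s Σ₀ Σ₀ Σ₀' U k →
          (k ≤ c * (∣ Σ₀ ∣ + ∣ Σ₀' ∣) + c)
        × (s ⊨ₚ U → ValidEntailment U Σ₀ Σ₀')
        × (⟦ U ⟧ₚ s ≡ false → ∃[ h ] (s , h ⊨ Σ₀ × ¬ (s , h ⊨ Σ₀'))) )
theorem2 = 2 , λ Σ₀ Σ₀′ s wf →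
  run (suc (size Σ₀ Σ₀′)) Σ₀ Σ₀′ ≤-refl ,
  (λ _ _ _ steps → ≤-trans (Steps≤size steps) (size≤linear Σ₀ Σ₀′)) ,
  λ U k r →
    ≤-trans (Run-steps≤size r) (size≤linear Σ₀ Σ₀′) ,
    (λ _ s′ h u sat → sound r s′ h u sat (λ _ a∈Σ₀ _ → a∈Σ₀)) ,
    λ ¬u → let mkCountermodel h sat ¬sat′ _ = complete r ¬u (λ T∈ → T∈) (WellFormed⇒Apart Σ₀ wf)
           in h , sat , ¬sat′
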